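{- Consider an acyclic full tensor network contraction $\mathrm{tc}(\mathcal{X}_1\times\cdots\times\mathcal{X}_p,E)$ in which every mode belongs to exactly one contraction, every contraction involves modes of two different tensors, and any two tensors share at most one contraction. For any $o\in\{1,\dots,p\}$, $$\mathrm{tc}(\mathcal{X}_1\times\cdots\times\mathcal{X}_p,E) = \mathrm{vec}(\mathcal{X}_o)^{\top} g(o), \qquad g(k) = \bigotimes_{l\in\Gamma(k)} \mathrm{mat}(\mathcal{X}_l)\, g(l).$$
   Context: Tensor contraction: for an order-$q$ tensor $\mathcal{X}$ and contractions $E$ (pairs $(u,v)$, $u\ne v$, of modes of equal size), $\mathrm{tc}(\mathcal{X},E)(\mathbf{i}_{K'})=\sum_{\mathbf{i}_K}\mathcal{X}(\mathbf{i})\prod_{(u,v)\in E}[i_u=i_v]$ with $K$ the contracted modes, $K'$ the rest; a tensor network contraction is $\mathrm{tc}(\mathcal{X}_1\times\cdots\times\mathcal{X}_p,E)$ where $(\mathcal{A}\times\mathcal{B})(\mathbf{i},\mathbf{j})=\mathcal{A}(\mathbf{i})\mathcal{B}(\mathbf{j})$ and modes are numbered consecutively; full means every mode is contracted. The tensor network is the graph with the tensors as vertices and an edge for each contraction between the two tensors owning its modes; acyclic means this graph has no cycle, so choosing $\mathcal{X}_o$ as root gives a rooted tree. $\Gamma(k)$ is the set of children of $\mathcal{X}_k$ in this rooted tree (tensors sharing a contraction with $\mathcal{X}_k$ and farther from the root), listed in the order of the corresponding modes of $\mathcal{X}_k$; the modes of each non-root tensor are arranged so that its first mode is the one contracted with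 its parent. $\mathrm{vec}$ lists tensor entries in lexicographic order; $\mathrm{mat}(\mathcal{X})$ is the mode-1 flattening, the matrix whose columns are the mode-1 fibers of $\mathcal{X}$ in lexicographic order. $\otimes$ is the Kronecker product, and an empty Kronecker product equals $1$ (so $g(k)=1$ for leaves). -}

module Defs where

open import Level using (Level)
open import Data.Bool.Base using (Bool; true; false; if_then_else_; _∧_)
open import Data.Nat.Base using (ℕ; zero; suc; _≡ᵇ_; _≤_)
open import Data.Nat.Properties using (_<?_)
open import Data.Fin.Base using (Fin; toℕ; fromℕ<; remQuot)
import Data.Fin.Base as Fin
open import Data.Fin.Properties using (_≟_)
open import Data.List.Base using (List; []; _∷_; length; lookup; allFin)
open import Data.Nat.ListAction using (product)
open import Data.Product.Base using (Σ; Σ-syntax; ∃; ∃-syntax; _×_; _,_; proj₁; proj₂)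
open import Data.Sum.Base using (_⊎_)
open import Data.Unit.Base using (⊤; tt)
open import Relation.Nullary using (¬_; yes; no; does)
open import Relation.Binary.PropositionalEquality using (_≡_; _≢_)
open import Algebra.Bundles using (CommutativeSemiring)
open import Data.List.Relation.Unary.Unique.Propositional using (Unique)

Idx : List ℕ → Set
Idx []       = ⊤
Idx (d ∷ ds) = Fin d × Idx ds

-- Lexicographic unflattening: Fin (d₁ ⋯ d_q) ≅ multi-indices, first index
-- most significant (remQuot is the inverse of  combine i j = i * n + j).
unflatten : (ds : List ℕ) → Fin (product ds) → Idx ds
unflatten []       _ = tt
unflatten (d ∷ ds) x = let (a , b) = remQuot (product ds) x in a , unflatten ds b

idxAt : (ds : List ℕ) → Idx ds → ℕ → ℕ
idxAt []       _        _       = 0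
idxAt (d ∷ ds) (a , _)  zero    = toℕ a
idxAt (d ∷ ds) (_ , is) (suc m) = idxAt ds is m

headD : List ℕ → ℕ
headD []      = 0
headD (d ∷ _) = d

tailL : List ℕ → List ℕ
tailL []       = []
tailL (_ ∷ ds) = ds

-- A mode is a pair (tensor, local mode); this is the
-- consecutive global numbering of modes of X₁ × ⋯ × X_p.

Mode : {p : ℕ} → (Fin p → List ℕ) → Set
Mode {p} ds = Σ[ k ∈ Fin p ] Fin (length (ds k))

dimOf : {p : ℕ} (ds : Fin p → List ℕ) → Mode ds → ℕ
dimOf ds (k , m) = lookup (ds k) m

module Graph {p n : ℕ} (ds : Fin p → List ℕ) (E : Fin n → Mode ds × Mode ds) where

  _∈ₑ_ : Mode ds → Mode ds × Mode ds → Set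
  u ∈ₑ e = (proj₁ e ≡ u) ⊎ (proj₂ e ≡ u)

  ends : Fin n → Fin p × Fin p
  ends j = proj₁ (proj₁ (E j)) , proj₁ (proj₂ (E j))

  SameSize : Set
  SameSize = ∀ j → dimOf ds (proj₁ (E j)) ≡ dimOf ds (proj₂ (E j))

  DifferentTensors : Set
  DifferentTensors = ∀ j → proj₁ (ends j) ≢ proj₂ (ends j)

  ExactlyOnce : Set
  ExactlyOnce = ∀ (u : Mode ds) →
    Σ[ j ∈ Fin n ] (u ∈ₑ E j × (∀ j′ → u ∈ₑ E j′ → j′ ≡ j))

  AtMostOne : Set
  AtMostOne = ∀ j j′ →
    (ends j ≡ ends j′ ⊎ (proj₁ (ends j) ≡ proj₂ (ends j′) × proj₂ (ends j) ≡ proj₁ (ends j′))) →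
    j ≡ j′

  Adj : Fin p → Fin p → Set
  Adj a b = ∃[ j ] ((ends j ≡ (a , b)) ⊎ (ends j ≡ (b , a)))

  data Walk : Fin p → Fin p → ℕ → Set where
    here : ∀ {a} → Walk a a 0
    step : ∀ {a b c ℓ} → Adj a b → Walk b c ℓ → Walk a c (suc ℓ)

  ClosedChain : Fin p → List (Fin p) → Set
  ClosedChain first []           = ⊤
  ClosedChain first (a ∷ [])     = Adj a first
  ClosedChain first (a ∷ b ∷ vs) = Adj a b × ClosedChain first (b ∷ vs)

  IsCycle : List (Fin p) → Set
  IsCycle vs = (3 ≤ length vs) × Unique vs × ChainFrom vs
    where
    ChainFrom : List (Fin p) → Set
    ChainFrom []       = ⊤
    ChainFrom (v ∷ ws) = ClosedChain v (v ∷ ws)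

  Acyclic : Set
  Acyclic = ∀ vs → ¬ IsCycle vs

  Connected : Set
  Connected = ∀ a b → ∃[ ℓ ] Walk a b ℓ

  IsDist : Fin p → Fin p → ℕ → Set
  IsDist a b d = Walk a b d × (∀ ℓ → Walk a b ℓ → d ≤ ℓ)

  -- Arrangement convention for root o: every non-root tensor l has a first
  -- mode, and that mode is contracted with the parent of l, i.e. with a
  -- tensor one step closer to the root o.
  ArrangedFor : Fin p → Set
  ArrangedFor o = ∀ l → l ≢ o →
    Σ[ z ∈ Fin (length (ds l)) ] (toℕ z ≡ 0 ×
      (∀ j (w : Mode ds) → (E j ≡ ((l , z) , w) ⊎ E j ≡ (w , (l , z))) →
        ∃[ d ] (IsDist o (proj₁ w) d × IsDist o l (suc d))))

  -- computational search: the tensor owning the partner of local mode m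
  -- (given as a natural number) of tensor k.  (Junk value k if none.)
  isMode : Fin p → ℕ → Mode ds → Bool
  isMode k m (k′ , m′) = does (k ≟ k′) ∧ (m ≡ᵇ toℕ m′)

  partnerTensor : Fin p → ℕ → Fin p
  partnerTensor k m = go (allFin n)
    where
    go : List (Fin n) → Fin p
    go []       = k
    go (j ∷ js) =
      if isMode k m (proj₁ (E j)) then proj₁ (proj₂ (E j))
      else if isMode k m (proj₂ (E j)) then proj₁ (proj₁ (E j))
      else go js

-- Scalars: an arbitrary commutative semiring R (the paper works over ℝ).

module Net {c ℓ : Level} (R : CommutativeSemiring c ℓ) where

  open CommutativeSemiring R using (Carrier; _+_; _*_; 0#; 1#)

  Tensor : List ℕ → Set c
  Tensor ds = Idx ds → Carrier

  Vector : ℕ → Set c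
  Vector n = Fin n → Carrier

  sumFin : (n : ℕ) → (Fin n → Carrier) → Carrier
  sumFin zero    f = 0#
  sumFin (suc n) f = f Fin.zero + sumFin n (λ i → f (Fin.suc i))

  prodFin : (n : ℕ) → (Fin n → Carrier) → Carrier
  prodFin zero    f = 1#
  prodFin (suc n) f = f Fin.zero * prodFin n (λ i → f (Fin.suc i))

  sumIdx : (ds : List ℕ) → (Idx ds → Carrier) → Carrier
  sumIdx []       f = f tt
  sumIdx (d ∷ ds) f = sumFin d (λ a → sumIdx ds (λ is → f (a , is)))

  sumΠ : (p : ℕ) (ds : Fin p → List ℕ) → (((k : Fin p) → Idx (ds k)) → Carrier) → Carrier
  sumΠ zero    ds f = f (λ ())
  sumΠ (suc p) ds f =
    sumIdx (ds Fin.zero) (λ a → sumΠ p (λ k → ds (Fin.suc k)) (λ g → f (cons a g)))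
    where
    cons : Idx (ds Fin.zero) → ((k : Fin p) → Idx (ds (Fin.suc k))) → (k : Fin (suc p)) → Idx (ds k)
    cons a g Fin.zero    = a
    cons a g (Fin.suc k) = g k

  iverson : ℕ → ℕ → Carrier
  iverson a b = if a ≡ᵇ b then 1# else 0#

  vec : (ds : List ℕ) → Tensor ds → Vector (product ds)
  vec ds X x = X (unflatten ds x)

  -- mat: mode-1 flattening; column j is the mode-1 fiber for the j-th
  -- (lexicographic) index of the remaining modes
  mat : (d : ℕ) (ds : List ℕ) → Tensor (d ∷ ds) → Fin d → Fin (product ds) → Carrier
  mat d ds X i j = X (i , unflatten ds j)

  dot : (n : ℕ) → Vector n → Vector n → Carrier
  dot n u v = sumFin n (λ i → u i * v i)

  matVec : (m n : ℕ) → (Fin m → Fin n → Carrier) → Vector n → Vector m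
  matVec m n A v i = sumFin n (λ j → A i j * v j)

  -- Kronecker product v₀ ⊗ v₁ ⊗ ⋯ ⊗ v_{r-1} of vectors of lengths ds
  -- (the factor at position i is v i (lookup ds i)); empty product = (1).
  -- (u ⊗ w)(i * |w| + j) = u i * w j.
  kron : (ds : List ℕ) → (ℕ → (m : ℕ) → Vector m) → Vector (product ds)
  kron []       v x = 1#
  kron (d ∷ ds) v x =
    let (a , b) = remQuot (product ds) x in v 0 d a * kron ds (λ i → v (suc i)) b

  -- reinterpret a vector of length m as one of length n (identity when
  -- m ≡ n; only used where equality of the sizes is a hypothesis)
  castV : (m n : ℕ) → Vector m → Vector n
  castV m n v j with toℕ j <? m
  ... | yes j<m = v (fromℕ< j<m)
  ... | no  _   = 0#

  -- mat(X) v for a tensor of arbitrary dimension list (junk for order 0)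
  matVecT : (ds : List ℕ) → Tensor ds → Vector (product (tailL ds)) → Vector (headD ds)
  matVecT []       X v ()
  matVecT (d ∷ ds) X v = matVec d (product ds) (mat d ds X) v

  -- The children of k, in the order of the corresponding modes of k, are
  -- the tensors contracted with the modes of k other than the parent
  -- mode: all modes for the root, modes 2,3,… for a non-root tensor (whose
  -- first mode is contracted with its parent).  The recursion is bounded
  -- by a fuel parameter; fuel p suffices since the tree has depth < p.

  module G {p n : ℕ} (ds : Fin p → List ℕ) (X : (k : Fin p) → Tensor (ds k))
           (E : Fin n → Mode ds × Mode ds) where

    open Graph ds E using (partnerTensor)

    mutual
      childVec : ℕ → Fin p → ℕ → (s : ℕ) → Vector s
      childVec f k m s =
        let l = partnerTensor k m in
        castV (headD (ds l)) s (matVecT (ds l) (X l) (gNonRoot f l))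

      gNonRoot : ℕ → (l : Fin p) → Vector (product (tailL (ds l)))
      gNonRoot zero    l = λ _ → 0#
      gNonRoot (suc f) l = kron (tailL (ds l)) (λ m → childVec f l (suc m))

  g : {p n : ℕ} (ds : Fin p → List ℕ) (X : (k : Fin p) → Tensor (ds k))
      (E : Fin n → Mode ds × Mode ds) (o : Fin p) → Vector (product (ds o))
  g {p} ds X E o = kron (ds o) (λ m → G.childVec ds X E p o m)

  tc : {p n : ℕ} (ds : Fin p → List ℕ) (X : (k : Fin p) → Tensor (ds k))
       (E : Fin n → Mode ds × Mode ds) → Carrier
  tc {p} {n} ds X E = sumΠ p ds (λ i →
      prodFin p (λ k → X k (i k))
    * prodFin n (λ j → let ((k , m) , (k′ , m′)) = E j in
        iverson (idxAt (ds k) (i k) (toℕ m)) (idxAt (ds k′) (i k′) (toℕ m′))))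

{-# OPTIONS --safe #-}
module Submission where

-- Rooted at o, the network is a tree: every tensor other than o is contracted with its parent
-- through its first mode and with its children through all its other modes, since a contraction
-- between two other modes would close a cycle with the two paths up to o (or, between a parent and
-- its child, duplicate the contraction joining them). The summand of tc is a product of one entry
-- of each tensor and one Iverson bracket per contraction, and it factorises along the tree: summing
-- out every index in the subtree of a non-root tensor c leaves a function of the index on the
-- contraction with c's parent alone, which is the corresponding entry of mat(X_c) g(c) by induction
-- on the height of the subtree. At the root what remains is vec(X_o)ᵀ g(o).

open import Defs
open import Level using (Level)
open import Algebra.Bundles using (CommutativeSemiring)
import Algebra.Properties.CommutativeSemigroup as CommSemigroupProperties
open import Data.Bool.Base using (Bool; true; false; if_then_else_; _∨_)
open import Data.Bool.Properties using (T-≡; ¬-not)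
open import Data.Nat.Base as ℕ using (ℕ; zero; suc; _≤_; _<_; z≤n; s≤s; _∸_)
import Data.Nat.Properties as ℕ
open import Data.Fin.Base as Fin using (Fin; toℕ; _↑ˡ_; _↑ʳ_; combine; fromℕ<)
open import Data.Fin.Properties
  using (_≟_; toℕ-injective; toℕ<n; toℕ-fromℕ<; remQuot-combine; suc-injective; 0≢1+n; pigeonhole)
open import Data.List.Base using (List; []; _∷_; length; map; allFin; tabulate; _++_; reverse)
open import Data.List.Properties using (map-tabulate; unfold-reverse; length-++; length-reverse)
open import Data.List.Membership.Propositional using (_∈_)
open import Data.List.Membership.Propositional.Properties using (∈-allFin)
open import Data.List.Relation.Unary.All as All using (All; []; _∷_)
open import Data.List.Relation.Unary.All.Properties using (All¬⇒¬Any)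
open import Data.List.Relation.Unary.Any using (here; there)
open import Data.List.Relation.Unary.Any.Properties using (reverse⁻)
open import Data.List.Relation.Unary.Unique.Propositional using (Unique; []; _∷_)
import Data.List.Relation.Unary.Unique.Propositional.Properties as Unique
open import Data.Nat.ListAction using (product)
open import Data.Maybe.Base using (Maybe; just; nothing)
open import Data.Product.Base using (Σ-syntax; ∃-syntax; _×_; _,_; proj₁; proj₂)
open import Data.Sum.Base using (_⊎_; inj₁; inj₂)
open import Data.Unit.Base using (tt)
open import Data.Empty using (⊥; ⊥-elim)
open import Function.Base using (_∘_)
open import Function.Bundles using (Equivalence)
open import Relation.Nullary using (yes; no; does; ¬_; Dec)
open import Relation.Nullary.Decidable using (dec-true; dec-false; decidable-stable)
open import Relation.Binary.PropositionalEquality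
  using (_≡_; _≢_; refl; cong; cong₂; sym; trans; subst; module ≡-Reasoning)

from-does : ∀ {P : Set} (P? : Dec P) → does P? ≡ true → P
from-does (yes p) _ = p

unique-reverse : ∀ {A : Set} (xs : List A) → Unique xs → Unique (reverse xs)
unique-reverse []       []            = []
unique-reverse (x ∷ xs) (x∉xs ∷ uniq) = subst Unique (sym (unfold-reverse x xs))
  (Unique.++⁺ (unique-reverse xs uniq) ([] ∷ [])
    λ { (x∈rev , here refl) → All¬⇒¬Any x∉xs (reverse⁻ x∈rev) })

∸-suc : ∀ {a b} → b < a → a ∸ b ≡ suc (a ∸ suc b)
∸-suc {a} {b} = ℕ.+-∸-assoc 1 {a} {suc b}

module Sums {c ℓ : Level} (R : CommutativeSemiring c ℓ) where

  open CommutativeSemiring R renaming (refl to ≈-refl; sym to ≈-sym; trans to ≈-trans)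
  open Net R
  open import Relation.Binary.Reasoning.Setoid setoid
  open CommSemigroupProperties +-commutativeSemigroup using () renaming (interchange to +-interchange)
  open CommSemigroupProperties *-commutativeSemigroup public using ()
    renaming (interchange to *-interchange; x∙yz≈y∙xz to *-exchange)

  sumFin-cong : ∀ n {f g : Fin n → Carrier} → (∀ i → f i ≈ g i) → sumFin n f ≈ sumFin n g
  sumFin-cong zero    f≈g = ≈-refl
  sumFin-cong (suc n) f≈g = +-cong (f≈g Fin.zero) (sumFin-cong n (λ i → f≈g (Fin.suc i)))

  sumFin-zero : ∀ n → sumFin n (λ _ → 0#) ≈ 0#
  sumFin-zero zero    = ≈-refl
  sumFin-zero (suc n) = ≈-trans (+-congˡ (sumFin-zero n)) (+-identityˡ 0#)

  sumFin-+ : ∀ n (f g : Fin n → Carrier) → sumFin n (λ i → f i + g i) ≈ sumFin n f + sumFin n g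
  sumFin-+ zero    f g = ≈-sym (+-identityˡ 0#)
  sumFin-+ (suc n) f g = ≈-trans (+-congˡ (sumFin-+ n _ _)) (+-interchange _ _ _ _)

  sumFin-*ˡ : ∀ n x (f : Fin n → Carrier) → sumFin n (λ i → x * f i) ≈ x * sumFin n f
  sumFin-*ˡ zero    x f = ≈-sym (zeroʳ x)
  sumFin-*ˡ (suc n) x f = ≈-trans (+-congˡ (sumFin-*ˡ n x _)) (≈-sym (distribˡ x _ _))

  sumFin-comm : ∀ m n (f : Fin m → Fin n → Carrier) →
    sumFin m (λ a → sumFin n (f a)) ≈ sumFin n (λ b → sumFin m (λ a → f a b))
  sumFin-comm zero    n f = ≈-sym (sumFin-zero n)
  sumFin-comm (suc m) n f = ≈-trans (+-congˡ (sumFin-comm m n (λ a → f (Fin.suc a)))) (≈-sym (sumFin-+ n _ _))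

  sumFin-↑ : ∀ a b (f : Fin (a ℕ.+ b) → Carrier) →
    sumFin (a ℕ.+ b) f ≈ sumFin a (λ i → f (i ↑ˡ b)) + sumFin b (λ j → f (a ↑ʳ j))
  sumFin-↑ zero    b f = ≈-sym (+-identityˡ _)
  sumFin-↑ (suc a) b f = ≈-trans (+-congˡ (sumFin-↑ a b (λ i → f (Fin.suc i)))) (≈-sym (+-assoc _ _ _))

  sumFin-combine : ∀ m k (f : Fin (m ℕ.* k) → Carrier) →
    sumFin (m ℕ.* k) f ≈ sumFin m (λ a → sumFin k (λ b → f (combine a b)))
  sumFin-combine zero    k f = ≈-refl
  sumFin-combine (suc m) k f =
    ≈-trans (sumFin-↑ k (m ℕ.* k) f) (+-congˡ (sumFin-combine m k (λ x → f (k ↑ʳ x))))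

  iverson-sym : ∀ a b → iverson a b ≡ iverson b a
  iverson-sym zero    zero    = refl
  iverson-sym zero    (suc b) = refl
  iverson-sym (suc a) zero    = refl
  iverson-sym (suc a) (suc b) = iverson-sym a b

  iverson-≢ : ∀ {a b} → a ≢ b → iverson a b ≡ 0#
  iverson-≢ {zero}  {zero}  a≢b with () ← a≢b refl
  iverson-≢ {zero}  {suc b} a≢b = refl
  iverson-≢ {suc a} {zero}  a≢b = refl
  iverson-≢ {suc a} {suc b} a≢b = iverson-≢ (λ a≡b → a≢b (cong suc a≡b))

  sumFin-iverson : ∀ n (y : Fin n) (f : Fin n → Carrier) →
    sumFin n (λ a → iverson (toℕ a) (toℕ y) * f a) ≈ f y
  sumFin-iverson (suc n) Fin.zero f = begin
    1# * f Fin.zero + sumFin n (λ a → 0# * f (Fin.suc a)) ≈⟨ +-cong (*-identityˡ _) (sumFin-cong n (λ a → zeroˡ _)) ⟩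
    f Fin.zero + sumFin n (λ _ → 0#)                      ≈⟨ +-congˡ (sumFin-zero n) ⟩
    f Fin.zero + 0#                                       ≈⟨ +-identityʳ _ ⟩
    f Fin.zero                                            ∎
  sumFin-iverson (suc n) (Fin.suc y) f =
    ≈-trans (+-cong (zeroˡ _) (sumFin-iverson n y (λ a → f (Fin.suc a)))) (+-identityˡ _)

  mask : Bool → Carrier → Carrier
  mask b x = if b then x else 1#

  prodFin-cong : ∀ n {f g : Fin n → Carrier} → (∀ i → f i ≈ g i) → prodFin n f ≈ prodFin n g
  prodFin-cong zero    f≈g = ≈-refl
  prodFin-cong (suc n) f≈g = *-cong (f≈g Fin.zero) (prodFin-cong n (λ i → f≈g (Fin.suc i)))

  prodFin-one : ∀ n → prodFin n (λ _ → 1#) ≈ 1#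
  prodFin-one zero    = ≈-refl
  prodFin-one (suc n) = ≈-trans (*-congˡ (prodFin-one n)) (*-identityˡ 1#)

  prodFin-* : ∀ n (f g : Fin n → Carrier) → prodFin n (λ i → f i * g i) ≈ prodFin n f * prodFin n g
  prodFin-* zero    f g = ≈-sym (*-identityˡ 1#)
  prodFin-* (suc n) f g = ≈-trans (*-congˡ (prodFin-* n _ _)) (*-interchange _ _ _ _)

  mask-∨ : ∀ a b x → (a ≡ true → b ≡ false) → mask (a ∨ b) x ≈ mask a x * mask b x
  mask-∨ true  b x a⇒¬b rewrite a⇒¬b refl = ≈-sym (*-identityʳ x)
  mask-∨ false b x _ = ≈-sym (*-identityˡ _)

  mask-≡ : ∀ b {x y} → (b ≡ true → x ≡ y) → mask b x ≡ mask b y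
  mask-≡ true  x≡y = x≡y refl
  mask-≡ false _   = refl

  prodFin-comm : ∀ m n (f : Fin m → Fin n → Carrier) →
    prodFin m (λ a → prodFin n (f a)) ≈ prodFin n (λ b → prodFin m (λ a → f a b))
  prodFin-comm zero    n f = ≈-sym (prodFin-one n)
  prodFin-comm (suc m) n f = ≈-trans (*-congˡ (prodFin-comm m n (λ a → f (Fin.suc a)))) (≈-sym (prodFin-* n _ _))

  prodFin-select : ∀ n (v : Fin n) (f : Fin n → Carrier) → prodFin n (λ k → mask (does (k ≟ v)) (f k)) ≈ f v
  prodFin-select (suc n) Fin.zero    f = ≈-trans (*-congˡ (prodFin-one n)) (*-identityʳ _)
  prodFin-select (suc n) (Fin.suc v) f = ≈-trans (*-identityˡ _) (prodFin-select n v (f ∘ Fin.suc))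

  sumIdx-cong : ∀ ds {f g : Idx ds → Carrier} → (∀ i → f i ≈ g i) → sumIdx ds f ≈ sumIdx ds g
  sumIdx-cong []       f≈g = f≈g tt
  sumIdx-cong (d ∷ ds) f≈g = sumFin-cong d (λ a → sumIdx-cong ds (λ is → f≈g (a , is)))

  sumIdx-*ˡ : ∀ ds x (f : Idx ds → Carrier) → sumIdx ds (λ i → x * f i) ≈ x * sumIdx ds f
  sumIdx-*ˡ []       x f = ≈-refl
  sumIdx-*ˡ (d ∷ ds) x f =
    ≈-trans (sumFin-cong d (λ a → sumIdx-*ˡ ds x _)) (sumFin-*ˡ d x _)

  sumIdx-*ʳ : ∀ ds x (f : Idx ds → Carrier) → sumIdx ds (λ i → f i * x) ≈ sumIdx ds f * x
  sumIdx-*ʳ ds x f = ≈-trans (sumIdx-cong ds (λ i → *-comm (f i) x))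
                             (≈-trans (sumIdx-*ˡ ds x f) (*-comm x _))

  sumIdx-sumFin-comm : ∀ ds n (f : Idx ds → Fin n → Carrier) →
    sumIdx ds (λ i → sumFin n (f i)) ≈ sumFin n (λ b → sumIdx ds (λ i → f i b))
  sumIdx-sumFin-comm []       n f = ≈-refl
  sumIdx-sumFin-comm (d ∷ ds) n f =
    ≈-trans (sumFin-cong d (λ a → sumIdx-sumFin-comm ds n _)) (sumFin-comm d n _)

  sumIdx-comm : ∀ ds es (f : Idx ds → Idx es → Carrier) →
    sumIdx ds (λ i → sumIdx es (f i)) ≈ sumIdx es (λ j → sumIdx ds (λ i → f i j))
  sumIdx-comm ds []       f = ≈-refl
  sumIdx-comm ds (e ∷ es) f =
    ≈-trans (sumIdx-sumFin-comm ds e _) (sumFin-cong e (λ b → sumIdx-comm ds es _))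

  sumΠ-cong : ∀ p (ds : Fin p → List ℕ) {f g : ((k : Fin p) → Idx (ds k)) → Carrier} →
    (∀ x → f x ≈ g x) → sumΠ p ds f ≈ sumΠ p ds g
  sumΠ-cong zero    ds f≈g = f≈g _
  sumΠ-cong (suc p) ds f≈g =
    sumIdx-cong (ds Fin.zero) (λ a → sumΠ-cong p (λ k → ds (Fin.suc k)) (λ _ → f≈g _))

  sumFin-unflatten : ∀ ds (f : Idx ds → Carrier) →
    sumFin (product ds) (λ x → f (unflatten ds x)) ≈ sumIdx ds f
  sumFin-unflatten []       f = +-identityʳ _
  sumFin-unflatten (d ∷ ds) f = ≈-trans (sumFin-combine d (product ds) _) (sumFin-cong d λ a →
    ≈-trans (sumFin-cong (product ds) λ b →
               reflexive (cong (λ (a′ , b′) → f (a′ , unflatten ds b′)) (remQuot-combine a b)))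
            (sumFin-unflatten ds (λ is → f (a , is))))

  padded : (d : ℕ) → Vector d → ℕ → Carrier
  padded d w t with t ℕ.<? d
  ... | yes t<d = w (fromℕ< t<d)
  ... | no  _   = 0#

  castV≡padded : ∀ d s (w : Vector d) (y : Fin s) → castV d s w y ≡ padded d w (toℕ y)
  castV≡padded d s w y with toℕ y ℕ.<? d
  ... | yes _ = refl
  ... | no  _ = refl

  padded≈sumFin : ∀ d (w : Vector d) t → padded d w t ≈ sumFin d (λ a → iverson (toℕ a) t * w a)
  padded≈sumFin d w t with t ℕ.<? d
  ... | yes t<d = ≈-sym (subst (λ t′ → sumFin d (λ a → iverson (toℕ a) t′ * w a) ≈ w (fromℕ< t<d))
                               (toℕ-fromℕ< t<d) (sumFin-iverson d (fromℕ< t<d) w))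
  ... | no  t≮d = ≈-sym (≈-trans (sumFin-cong d (λ a → ≈-trans (*-congʳ (reflexive (iverson-≢ (a≢t a)))) (zeroˡ _)))
                                 (sumFin-zero d))
    where
    a≢t : ∀ a → toℕ a ≢ t
    a≢t a refl = t≮d (toℕ<n a)

  kron-unflatten : ∀ ds (v : ℕ → (m : ℕ) → Vector m) (W : ℕ → ℕ → Carrier) →
    (∀ m s y → v m s y ≈ W m (toℕ y)) → ∀ x →
    kron ds v x ≈ prodFin (length ds) (λ r → W (toℕ r) (idxAt ds (unflatten ds x) (toℕ r)))
  kron-unflatten []       v W v≈W x = ≈-refl
  kron-unflatten (d ∷ ds) v W v≈W x =
    *-cong (v≈W 0 d _) (kron-unflatten ds (λ m → v (suc m)) (λ m → W (suc m)) (λ m → v≈W (suc m)) _)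

  padded-matVec : ∀ d ds (T : Tensor (d ∷ ds)) (w : Vector (product ds)) (G : Idx ds → Carrier) →
    (∀ x → w x ≈ G (unflatten ds x)) → ∀ t →
    padded d (matVecT (d ∷ ds) T w) t ≈ sumIdx (d ∷ ds) (λ (a , as) → T (a , as) * (iverson (toℕ a) t * G as))
  padded-matVec d ds T w G w≈G t = begin
    padded d (matVecT (d ∷ ds) T w) t
      ≈⟨ padded≈sumFin d _ t ⟩
    sumFin d (λ a → iverson (toℕ a) t * sumFin (product ds) (λ x → T (a , unflatten ds x) * w x))
      ≈⟨ sumFin-cong d (λ a → *-congˡ (≈-trans (sumFin-cong (product ds) (λ x → *-congˡ (w≈G x)))
                                               (sumFin-unflatten ds (λ as → T (a , as) * G as)))) ⟩
    sumFin d (λ a → iverson (toℕ a) t * sumIdx ds (λ as → T (a , as) * G as))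
      ≈⟨ sumFin-cong d (λ a → ≈-sym (≈-trans (sumIdx-cong ds (λ as → *-exchange _ _ _)) (sumIdx-*ˡ ds _ _))) ⟩
    sumFin d (λ a → sumIdx ds (λ as → T (a , as) * (iverson (toℕ a) t * G as))) ∎

  padded-matVecT-kron : ∀ dl → 0 < length dl → (T : Tensor dl) (v : ℕ → (m : ℕ) → Vector m) (W : ℕ → ℕ → Carrier) →
    (∀ m s y → v m s y ≈ W m (toℕ y)) → ∀ t →
    padded (headD dl) (matVecT dl T (kron (tailL dl) v)) t
      ≈ sumIdx dl (λ a → T a * (iverson (idxAt dl a 0) t *
                                 prodFin (length (tailL dl)) (λ r → W (toℕ r) (idxAt dl a (suc (toℕ r))))))
  padded-matVecT-kron (d ∷ ds) _ T v W v≈W =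
    padded-matVec d ds T (kron ds v) (λ as → prodFin (length ds) (λ r → W (toℕ r) (idxAt ds as (toℕ r))))
                  (kron-unflatten ds v W v≈W)

  dot-vec-kron : ∀ dl (T : Tensor dl) (v : ℕ → (m : ℕ) → Vector m) (W : ℕ → ℕ → Carrier) →
    (∀ m s y → v m s y ≈ W m (toℕ y)) →
    dot (product dl) (vec dl T) (kron dl v)
      ≈ sumIdx dl (λ a → T a * prodFin (length dl) (λ r → W (toℕ r) (idxAt dl a (toℕ r))))
  dot-vec-kron dl T v W v≈W =
    ≈-trans (sumFin-cong (product dl) (λ x → *-congˡ (kron-unflatten dl v W v≈W x)))
            (sumFin-unflatten dl (λ a → T a * prodFin (length dl) (λ r → W (toℕ r) (idxAt dl a (toℕ r)))))

module PartialSums {c ℓ : Level} (R : CommutativeSemiring c ℓ) {p : ℕ} (ds : Fin p → List ℕ) where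

  open CommutativeSemiring R renaming (refl to ≈-refl; sym to ≈-sym; trans to ≈-trans)
  open Net R
  open Sums R
  open import Relation.Binary.Reasoning.Setoid setoid

  Assignment : Set
  Assignment = (k : Fin p) → Maybe (Idx (ds k))

  unassigned : Assignment
  unassigned _ = nothing

  _≐_ : Assignment → Assignment → Set
  i ≐ i′ = ∀ k → i k ≡ i′ k

  Extensional : (Assignment → Carrier) → Set ℓ
  Extensional F = ∀ {i i′} → i ≐ i′ → F i ≈ F i′

  _[_]≔_ : Assignment → (k : Fin p) → Idx (ds k) → Assignment
  (i [ k ]≔ a) k′ with k ≟ k′
  ... | yes refl = just a
  ... | no  _    = i k′

  []≔-same : ∀ i k a → (i [ k ]≔ a) k ≡ just a
  []≔-same i k a with k ≟ k
  ... | yes refl = refl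
  ... | no  k≢k  = ⊥-elim (k≢k refl)

  []≔-other : ∀ i {k} a {k′} → k ≢ k′ → (i [ k ]≔ a) k′ ≡ i k′
  []≔-other i {k} a {k′} k≢k′ with k ≟ k′
  ... | yes refl = ⊥-elim (k≢k′ refl)
  ... | no  _    = refl

  []≔-cong : ∀ {i i′} → i ≐ i′ → ∀ k a → (i [ k ]≔ a) ≐ (i′ [ k ]≔ a)
  []≔-cong i≐i′ k a k′ with k ≟ k′
  ... | yes refl = refl
  ... | no  _    = i≐i′ k′

  []≔-comm : ∀ i {k k′} a b → k ≢ k′ → ((i [ k′ ]≔ b) [ k ]≔ a) ≐ ((i [ k ]≔ a) [ k′ ]≔ b)
  []≔-comm i {k} {k′} a b k≢k′ v = by-cases (k ≟ v) (k′ ≟ v)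
    where
    by-cases : Dec (k ≡ v) → Dec (k′ ≡ v) → ((i [ k′ ]≔ b) [ k ]≔ a) v ≡ ((i [ k ]≔ a) [ k′ ]≔ b) v
    by-cases (yes refl) (yes refl) = ⊥-elim (k≢k′ refl)
    by-cases (yes refl) (no k′≢v)  =
      trans ([]≔-same _ k a) (sym (trans ([]≔-other _ b k′≢v) ([]≔-same i k a)))
    by-cases (no k≢v)   (yes refl) =
      trans ([]≔-other _ a k≢v) (trans ([]≔-same i k′ b) (sym ([]≔-same _ k′ b)))
    by-cases (no k≢v)   (no k′≢v)  =
      trans ([]≔-other _ a k≢v) (trans ([]≔-other i b k′≢v)
        (sym (trans ([]≔-other _ b k′≢v) ([]≔-other i a k≢v))))

  sumOver : List (Fin p) → (Fin p → Bool) → (Assignment → Carrier) → Assignment → Carrier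
  sumOver []      P F i = F i
  sumOver (k ∷ L) P F i =
    if P k then sumIdx (ds k) (λ a → sumOver L P F (i [ k ]≔ a)) else sumOver L P F i

  Independent : (Fin p → Bool) → (Assignment → Carrier) → Set ℓ
  Independent P G = ∀ i k a → P k ≡ true → G (i [ k ]≔ a) ≈ G i

  Disjoint : (Fin p → Bool) → (Fin p → Bool) → Set
  Disjoint P Q = ∀ k → P k ≡ true → Q k ≡ true → ⊥

  sumOver-cong : ∀ L P {F G} → (∀ i → F i ≈ G i) → ∀ i → sumOver L P F i ≈ sumOver L P G i
  sumOver-cong []      P F≈G i = F≈G i
  sumOver-cong (k ∷ L) P F≈G i with P k
  ... | true  = sumIdx-cong (ds k) (λ a → sumOver-cong L P F≈G (i [ k ]≔ a))
  ... | false = sumOver-cong L P F≈G i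

  sumOver-extensional : ∀ L P {F} → Extensional F → Extensional (sumOver L P F)
  sumOver-extensional []      P ext i≐i′ = ext i≐i′
  sumOver-extensional (k ∷ L) P ext i≐i′ with P k
  ... | true  = sumIdx-cong (ds k) (λ a → sumOver-extensional L P ext ([]≔-cong i≐i′ k a))
  ... | false = sumOver-extensional L P ext i≐i′

  sumOver-predicate-cong : ∀ L {P Q} F → (∀ k → P k ≡ Q k) → ∀ i → sumOver L P F i ≈ sumOver L Q F i
  sumOver-predicate-cong []      F P≡Q i = ≈-refl
  sumOver-predicate-cong (k ∷ L) {Q = Q} F P≡Q i rewrite P≡Q k with Q k
  ... | true  = sumIdx-cong (ds k) (λ a → sumOver-predicate-cong L F P≡Q (i [ k ]≔ a))
  ... | false = sumOver-predicate-cong L F P≡Q i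

  sumOver-*ʳ : ∀ L P F G → Independent P G → ∀ i → sumOver L P (λ i′ → F i′ * G i′) i ≈ sumOver L P F i * G i
  sumOver-*ʳ []      P F G indep i = ≈-refl
  sumOver-*ʳ (k ∷ L) P F G indep i with P k in Pk
  ... | true  = ≈-trans (sumIdx-cong (ds k) (λ a → ≈-trans (sumOver-*ʳ L P F G indep (i [ k ]≔ a))
                                                           (*-congˡ (indep i k a Pk))))
                        (sumIdx-*ʳ (ds k) (G i) _)
  ... | false = sumOver-*ʳ L P F G indep i

  sumOver-*ˡ : ∀ L P F G → Independent P G → ∀ i → sumOver L P (λ i′ → G i′ * F i′) i ≈ G i * sumOver L P F i
  sumOver-*ˡ L P F G indep i = ≈-trans (sumOver-cong L P (λ i′ → *-comm (G i′) (F i′)) i)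
                                       (≈-trans (sumOver-*ʳ L P F G indep i) (*-comm _ _))

  sumOver-sumIdx-comm : ∀ L P es (H : Idx es → Assignment → Carrier) i →
    sumOver L P (λ i′ → sumIdx es (λ a → H a i′)) i ≈ sumIdx es (λ a → sumOver L P (H a) i)
  sumOver-sumIdx-comm []      P es H i = ≈-refl
  sumOver-sumIdx-comm (k ∷ L) P es H i with P k
  ... | true  = ≈-trans (sumIdx-cong (ds k) (λ b → sumOver-sumIdx-comm L P es H (i [ k ]≔ b)))
                        (sumIdx-comm (ds k) es _)
  ... | false = sumOver-sumIdx-comm L P es H i

  sumOver-[]≔ : ∀ L P H k a → All (k ≢_) L → Extensional H → ∀ i →
    sumOver L P (λ i′ → H (i′ [ k ]≔ a)) i ≈ sumOver L P H (i [ k ]≔ a)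
  sumOver-[]≔ []       P H k a _             ext i = ≈-refl
  sumOver-[]≔ (k′ ∷ L) P H k a (k≢k′ ∷ k∉L) ext i with P k′
  ... | true  = sumIdx-cong (ds k′) (λ b → ≈-trans (sumOver-[]≔ L P H k a k∉L ext (i [ k′ ]≔ b))
                                                   (sumOver-extensional L P ext ([]≔-comm i a b k≢k′)))
  ... | false = sumOver-[]≔ L P H k a k∉L ext i

  sumOver-∨ : ∀ L P Q F → Unique L → Disjoint P Q → Extensional F → ∀ i →
    sumOver L (λ k → P k ∨ Q k) F i ≈ sumOver L P (sumOver L Q F) i
  sumOver-∨ []      P Q F _             disj ext i = ≈-refl
  sumOver-∨ (k ∷ L) P Q F (k∉L ∷ uniq) disj ext i with P k in Pk | Q k in Qk
  ... | true  | true  = ⊥-elim (disj k Pk Qk)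
  ... | true  | false = sumIdx-cong (ds k) (λ a → sumOver-∨ L P Q F uniq disj ext (i [ k ]≔ a))
  ... | false | false = sumOver-∨ L P Q F uniq disj ext i
  ... | false | true  = begin
    sumIdx (ds k) (λ a → sumOver L (λ k → P k ∨ Q k) F (i [ k ]≔ a))
      ≈⟨ sumIdx-cong (ds k) (λ a → sumOver-∨ L P Q F uniq disj ext (i [ k ]≔ a)) ⟩
    sumIdx (ds k) (λ a → sumOver L P (sumOver L Q F) (i [ k ]≔ a))
      ≈⟨ sumIdx-cong (ds k) (λ a → ≈-sym (sumOver-[]≔ L P (sumOver L Q F) k a k∉L (sumOver-extensional L Q ext) i)) ⟩
    sumIdx (ds k) (λ a → sumOver L P (λ i′ → sumOver L Q F (i′ [ k ]≔ a)) i)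
      ≈⟨ sumOver-sumIdx-comm L P (ds k) (λ a i′ → sumOver L Q F (i′ [ k ]≔ a)) i ⟨
    sumOver L P (λ i′ → sumIdx (ds k) (λ a → sumOver L Q F (i′ [ k ]≔ a))) i ∎

  sumOver-none : ∀ L P F → All (λ k → P k ≡ false) L → ∀ i → sumOver L P F i ≈ F i
  sumOver-none []      P F []           i = ≈-refl
  sumOver-none (k ∷ L) P F (Pk ∷ none) i rewrite Pk = sumOver-none L P F none i

  sumOver-≟ : ∀ L F v → v ∈ L → Unique L → ∀ i →
    sumOver L (λ k → does (k ≟ v)) F i ≈ sumIdx (ds v) (λ a → F (i [ v ]≔ a))
  sumOver-≟ (k ∷ L) F v (here refl) (k∉L ∷ _) i rewrite dec-true (k ≟ k) refl =
    sumIdx-cong (ds k) (λ a → sumOver-none L _ F (All.map (λ k≢k′ → dec-false (_ ≟ k) (k≢k′ ∘ sym)) k∉L)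
                                          (i [ k ]≔ a))
  sumOver-≟ (k ∷ L) F v (there v∈L) (k∉L ∷ uniq) i with k ≟ v
  ... | yes refl = ⊥-elim (All¬⇒¬Any k∉L v∈L)
  ... | no  _    = sumOver-≟ L F v v∈L uniq i

  ⋃ : (K : ℕ) → (Fin K → Fin p → Bool) → Fin p → Bool
  ⋃ zero    U k = false
  ⋃ (suc K) U k = U Fin.zero k ∨ ⋃ K (λ r → U (Fin.suc r)) k

  ⋃-true⁻ : ∀ K U k → ⋃ K U k ≡ true → Σ[ r ∈ Fin K ] U r k ≡ true
  ⋃-true⁻ (suc K) U k ⋃≡true with U Fin.zero k in U₀k
  ... | true  = Fin.zero , U₀k
  ... | false = let r , Urk = ⋃-true⁻ K (λ r → U (Fin.suc r)) k ⋃≡true in Fin.suc r , Urk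

  ⋃-true⁺ : ∀ K U k r → U r k ≡ true → ⋃ K U k ≡ true
  ⋃-true⁺ (suc K) U k Fin.zero    Urk rewrite Urk = refl
  ⋃-true⁺ (suc K) U k (Fin.suc r) Urk with U Fin.zero k
  ... | true  = refl
  ... | false = ⋃-true⁺ K (λ r → U (Fin.suc r)) k r Urk

  ⋃-false⁺ : ∀ K U k → (∀ r → U r k ≡ false) → ⋃ K U k ≡ false
  ⋃-false⁺ zero    U k _    = refl
  ⋃-false⁺ (suc K) U k none rewrite none Fin.zero = ⋃-false⁺ K (λ r → U (Fin.suc r)) k (λ r → none (Fin.suc r))

  PairwiseDisjoint : (K : ℕ) → (Fin K → Fin p → Bool) → Set
  PairwiseDisjoint K U = ∀ r r′ k → U r k ≡ true → U r′ k ≡ true → r ≡ r′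

  pairwiseDisjoint-suc : ∀ {K U} → PairwiseDisjoint (suc K) U → PairwiseDisjoint K (λ r → U (Fin.suc r))
  pairwiseDisjoint-suc disj r r′ k Urk Ur′k = suc-injective (disj (Fin.suc r) (Fin.suc r′) k Urk Ur′k)

  mask-⋃ : ∀ K U → PairwiseDisjoint K U → ∀ k x → mask (⋃ K U k) x ≈ prodFin K (λ r → mask (U r k) x)
  mask-⋃ zero    U _    k x = ≈-refl
  mask-⋃ (suc K) U disj k x =
    ≈-trans (mask-∨ (U Fin.zero k) _ x first-only) (*-congˡ (mask-⋃ K _ (pairwiseDisjoint-suc disj) k x))
    where
    first-only : U Fin.zero k ≡ true → ⋃ K (λ r → U (Fin.suc r)) k ≡ false
    first-only U₀k = ⋃-false⁺ K _ k (λ r → ¬-not (λ Urk → 0≢1+n (disj _ _ k U₀k Urk)))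

  -- Fubini for a product whose r-th factor only involves the tensors in U r.
  sumOver-⋃-prodFin : ∀ L → Unique L → ∀ K U (F G : Fin K → Assignment → Carrier) → PairwiseDisjoint K U →
    (∀ r → Extensional (F r)) →
    (∀ r r′ → r ≢ r′ → Independent (U r′) (F r)) →
    (∀ r r′ → Independent (U r′) (G r)) →
    (∀ r i → sumOver L (U r) (F r) i ≈ G r i) →
    ∀ i → sumOver L (⋃ K U) (λ i′ → prodFin K (λ r → F r i′)) i ≈ prodFin K (λ r → G r i)
  sumOver-⋃-prodFin L uniq zero    U F G _ _ _ _ _ i = sumOver-none L _ _ (All.universal (λ _ → refl) L) i
  sumOver-⋃-prodFin L uniq (suc K) U F G disj ext indepF indepG sumF≈G i = begin
    sumOver L (λ k → U₀ k ∨ U₊ k) (λ i′ → F Fin.zero i′ * ∏F₊ i′) i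
      ≈⟨ sumOver-∨ L U₀ U₊ _ uniq disj₀₊ ext₀₊ i ⟩
    sumOver L U₀ (sumOver L U₊ (λ i′ → F Fin.zero i′ * ∏F₊ i′)) i
      ≈⟨ sumOver-cong L U₀ (sumOver-*ˡ L U₊ ∏F₊ (F Fin.zero) indepF₀) i ⟩
    sumOver L U₀ (λ i′ → F Fin.zero i′ * sumOver L U₊ ∏F₊ i′) i
      ≈⟨ sumOver-cong L U₀ (λ i′ → *-congˡ (sumOver-⋃-prodFin L uniq K _ (F ∘ Fin.suc) (G ∘ Fin.suc)
           (pairwiseDisjoint-suc disj) (ext ∘ Fin.suc) (λ r r′ r≢r′ → indepF _ _ (r≢r′ ∘ suc-injective))
           (λ r r′ → indepG _ _) (sumF≈G ∘ Fin.suc) i′)) i ⟩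
    sumOver L U₀ (λ i′ → F Fin.zero i′ * ∏G₊ i′) i
      ≈⟨ sumOver-*ʳ L U₀ (F Fin.zero) ∏G₊ (λ i k a U₀k → prodFin-cong K (λ r → indepG _ Fin.zero i k a U₀k)) i ⟩
    sumOver L U₀ (F Fin.zero) i * ∏G₊ i
      ≈⟨ *-congʳ (sumF≈G Fin.zero i) ⟩
    G Fin.zero i * ∏G₊ i ∎
    where
    U₀ = U Fin.zero
    U₊ = ⋃ K (λ r → U (Fin.suc r))
    ∏F₊ ∏G₊ : Assignment → Carrier
    ∏F₊ i′ = prodFin K (λ r → F (Fin.suc r) i′)
    ∏G₊ i′ = prodFin K (λ r → G (Fin.suc r) i′)
    ext₀₊ : Extensional (λ i′ → F Fin.zero i′ * ∏F₊ i′)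
    ext₀₊ i≐i′ = *-cong (ext Fin.zero i≐i′) (prodFin-cong K (λ r → ext (Fin.suc r) i≐i′))
    disj₀₊ : Disjoint U₀ U₊
    disj₀₊ k U₀k U₊k with r , Urk ← ⋃-true⁻ K _ k U₊k with () ← disj Fin.zero (Fin.suc r) k U₀k Urk
    indepF₀ : Independent U₊ (F Fin.zero)
    indepF₀ i k a U₊k with r , Urk ← ⋃-true⁻ K _ k U₊k = indepF Fin.zero (Fin.suc r) (λ ()) i k a Urk

module _ {c ℓ : Level} (R : CommutativeSemiring c ℓ) where

  open CommutativeSemiring R renaming (refl to ≈-refl; sym to ≈-sym; trans to ≈-trans)
  open Net R
  open Sums R
  open import Relation.Binary.Reasoning.Setoid setoid

  module Tail {p : ℕ} (ds : Fin (suc p) → List ℕ) where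

    module Big   = PartialSums R ds
    module Small = PartialSums R (λ k → ds (Fin.suc k))

    _◂_ : Maybe (Idx (ds Fin.zero)) → Small.Assignment → Big.Assignment
    (x ◂ i) Fin.zero    = x
    (x ◂ i) (Fin.suc k) = i k

    ◂-cong : ∀ {x y i i′} → x ≡ y → i Small.≐ i′ → (x ◂ i) Big.≐ (y ◂ i′)
    ◂-cong x≡y i≐i′ Fin.zero    = x≡y
    ◂-cong x≡y i≐i′ (Fin.suc k) = i≐i′ k

    tail-[]≔ : ∀ (i : Big.Assignment) k a →
      (λ k′ → (i Big.[ Fin.suc k ]≔ a) (Fin.suc k′)) Small.≐ ((λ k′ → i (Fin.suc k′)) Small.[ k ]≔ a)
    tail-[]≔ i k a k′ = by-cases (k ≟ k′)
      where
      by-cases : Dec (k ≡ k′) → (i Big.[ Fin.suc k ]≔ a) (Fin.suc k′) ≡ ((λ k″ → i (Fin.suc k″)) Small.[ k ]≔ a) k′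
      by-cases (yes refl) = trans (Big.[]≔-same i (Fin.suc k) a) (sym (Small.[]≔-same _ k a))
      by-cases (no k≢k′)  = trans (Big.[]≔-other i a (k≢k′ ∘ suc-injective)) (sym (Small.[]≔-other _ a k≢k′))

    sumOver-map-suc : ∀ L P F → Big.Extensional F → ∀ i →
      Big.sumOver (map Fin.suc L) P F i
        ≈ Small.sumOver L (λ k → P (Fin.suc k)) (λ i′ → F (i Fin.zero ◂ i′)) (λ k → i (Fin.suc k))
    sumOver-map-suc []      P F ext i = ext λ { Fin.zero → refl ; (Fin.suc k) → refl }
    sumOver-map-suc (k ∷ L) P F ext i with P (Fin.suc k)
    ... | false = sumOver-map-suc L P F ext i
    ... | true  = sumIdx-cong (ds (Fin.suc k)) λ a →
      ≈-trans (sumOver-map-suc L P F ext (i Big.[ Fin.suc k ]≔ a))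
        (≈-trans (Small.sumOver-cong L _ (λ i′ → ext (◂-cong (Big.[]≔-other i a (λ ())) (λ _ → refl))) _)
                 (Small.sumOver-extensional L _ (ext ∘ ◂-cong refl) (tail-[]≔ i k a)))

  sumΠ≈sumOver : ∀ p (ds : Fin p → List ℕ) (F : PartialSums.Assignment R ds → Carrier) →
    PartialSums.Extensional R ds F → ∀ i →
    sumΠ p ds (λ g → F (λ k → just (g k))) ≈ PartialSums.sumOver R ds (allFin p) (λ _ → true) F i
  sumΠ≈sumOver zero    ds F ext i = ext (λ ())
  sumΠ≈sumOver (suc p) ds F ext i = sumIdx-cong (ds Fin.zero) λ a → begin
    sumΠ p (λ k → ds (Fin.suc k)) _
      ≈⟨ sumΠ-cong p _ (λ g → ext λ { Fin.zero → refl ; (Fin.suc k) → refl }) ⟩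
    sumΠ p (λ k → ds (Fin.suc k)) (λ g → F (just a ◂ (λ k → just (g k))))
      ≈⟨ sumΠ≈sumOver p _ (λ i′ → F (just a ◂ i′)) (ext ∘ ◂-cong refl) (tail (i [0]≔ a)) ⟩
    Small.sumOver (allFin p) _ (λ i′ → F (just a ◂ i′)) (tail (i [0]≔ a))
      ≈⟨ Small.sumOver-cong (allFin p) _ (λ i′ → ext (◂-cong (Big.[]≔-same i Fin.zero a) (λ _ → refl))) _ ⟨
    Small.sumOver (allFin p) _ (λ i′ → F ((i [0]≔ a) Fin.zero ◂ i′)) (tail (i [0]≔ a))
      ≈⟨ sumOver-map-suc (allFin p) _ F ext (i [0]≔ a) ⟨
    Big.sumOver (map Fin.suc (allFin p)) _ F (i [0]≔ a)
      ≡⟨ cong (λ L → Big.sumOver L (λ _ → true) F (i [0]≔ a)) (map-tabulate (λ k → k) Fin.suc) ⟩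
    Big.sumOver (tabulate Fin.suc) _ F (i [0]≔ a) ∎
    where
    open Tail ds
    _[0]≔_ : Big.Assignment → Idx (ds Fin.zero) → Big.Assignment
    i′ [0]≔ a = i′ Big.[ Fin.zero ]≔ a
    tail : Big.Assignment → Small.Assignment
    tail i′ k = i′ (Fin.suc k)

module PartnerSearch {p n : ℕ} (ds : Fin p → List ℕ) (E : Fin n → Mode ds × Mode ds) (k : Fin p) (m : ℕ) where

  -- The search function local to Graph.partnerTensor, named by unification.
  mutual
    search : List (Fin n) → Fin p
    search = _

    partnerTensor≡search : Graph.partnerTensor ds E k m ≡ search (allFin n)
    partnerTensor≡search with allFin n
    ... | _ = refl

module Paths {p n : ℕ} (ds : Fin p → List ℕ) (E : Fin n → Mode ds × Mode ds) where

  open Graph ds E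

  adj-sym : ∀ {a b} → Adj a b → Adj b a
  adj-sym (j , inj₁ eq) = j , inj₂ eq
  adj-sym (j , inj₂ eq) = j , inj₁ eq

  walk-snoc : ∀ {a b c ℓ} → Walk a b ℓ → Adj b c → Walk a c (suc ℓ)
  walk-snoc here        b~c = step b~c here
  walk-snoc (step a~ w) b~c = step a~ (walk-snoc w b~c)

  isDist-unique : ∀ {a b d d′} → IsDist a b d → IsDist a b d′ → d ≡ d′
  isDist-unique (w , min) (w′ , min′) = ℕ.≤-antisym (min _ w′) (min′ _ w)

  data Path : Fin p → Fin p → List (Fin p) → Set where
    [_] : ∀ a → Path a a (a ∷ [])
    _∷_ : ∀ {a b c L} → Adj a b → Path b c L → Path a c (a ∷ L)

  path-++ : ∀ {a b c d L M} → Path a b L → Adj b c → Path c d M → Path a d (L ++ M)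
  path-++ [ _ ]    b~c Q = b~c ∷ Q
  path-++ (a~ ∷ P) b~c Q = a~ ∷ path-++ P b~c Q

  path-reverse : ∀ {a b L} → Path a b L → Path b a (reverse L)
  path-reverse [ a ]                 = [ a ]
  path-reverse {a} (_∷_ {L = L} a~ P) =
    subst (Path _ a) (sym (unfold-reverse a L)) (path-++ (path-reverse P) (adj-sym a~) [ a ])

  path-closedChain : ∀ {a b f L} → Path a b L → Adj b f → ClosedChain f L
  path-closedChain [ _ ]           b~f = b~f
  path-closedChain (a~ ∷ [ _ ])    b~f = a~ , b~f
  path-closedChain (a~ ∷ (b~ ∷ P)) b~f = a~ , path-closedChain (b~ ∷ P) b~f

  path-cycle : ∀ {v c L} → Path v c L → Adj c v → Unique L → 3 ≤ length L → IsCycle L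
  path-cycle P@([ _ ]) c~v uniq 3≤L = 3≤L , uniq , path-closedChain P c~v
  path-cycle P@(_ ∷ _) c~v uniq 3≤L = 3≤L , uniq , path-closedChain P c~v

module Contractions {p n : ℕ} (ds : Fin p → List ℕ) (E : Fin n → Mode ds × Mode ds)
  (different : Graph.DifferentTensors ds E) (exactlyOnce : Graph.ExactlyOnce ds E) where

  open Graph ds E
  open Paths ds E

  Joins : Fin n → Mode ds → Mode ds → Set
  Joins j u w = E j ≡ (u , w) ⊎ E j ≡ (w , u)

  mode-≡ : ∀ {w w′ : Mode ds} → proj₁ w ≡ proj₁ w′ → toℕ (proj₂ w) ≡ toℕ (proj₂ w′) → w ≡ w′
  mode-≡ {a , m} {.a , m′} refl m≡m′ = cong (a ,_) (toℕ-injective m≡m′)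

  edgeOf : Mode ds → Fin n
  edgeOf u = proj₁ (exactlyOnce u)

  edgeOf-unique : ∀ {u j} → u ∈ₑ E j → j ≡ edgeOf u
  edgeOf-unique {u} {j} = proj₂ (proj₂ (exactlyOnce u)) j

  partner : Mode ds → Mode ds
  partner u = other (proj₁ (proj₂ (exactlyOnce u)))
    where
    other : u ∈ₑ E (edgeOf u) → Mode ds
    other (inj₁ _) = proj₂ (E (edgeOf u))
    other (inj₂ _) = proj₁ (E (edgeOf u))

  joins⇒∈ₑ : ∀ {j u w} → Joins j u w → u ∈ₑ E j
  joins⇒∈ₑ (inj₁ eq) = inj₁ (cong proj₁ eq)
  joins⇒∈ₑ (inj₂ eq) = inj₂ (cong proj₂ eq)

  joins-sym : ∀ {j u w} → Joins j u w → Joins j w u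
  joins-sym (inj₁ eq) = inj₂ eq
  joins-sym (inj₂ eq) = inj₁ eq

  joins-endpoint : ∀ {j u w x} → Joins j u w → x ∈ₑ E j → x ≡ u ⊎ x ≡ w
  joins-endpoint (inj₁ eq) (inj₁ refl) = inj₁ (cong proj₁ eq)
  joins-endpoint (inj₁ eq) (inj₂ refl) = inj₂ (cong proj₂ eq)
  joins-endpoint (inj₂ eq) (inj₁ refl) = inj₂ (cong proj₁ eq)
  joins-endpoint (inj₂ eq) (inj₂ refl) = inj₁ (cong proj₂ eq)

  partner-joins : ∀ u → Joins (edgeOf u) u (partner u)
  partner-joins u with proj₁ (proj₂ (exactlyOnce u))
  ... | inj₁ eq = inj₁ (cong (_, proj₂ (E (edgeOf u))) eq)
  ... | inj₂ eq = inj₂ (cong (proj₁ (E (edgeOf u)) ,_) eq)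

  joins-functional : ∀ {j u w w′} → Joins j u w → Joins j u w′ → w ≡ w′
  joins-functional (inj₁ eq) (inj₁ eq′) = cong proj₂ (trans (sym eq) eq′)
  joins-functional (inj₁ eq) (inj₂ eq′) = trans (cong proj₂ (trans (sym eq) eq′)) (cong proj₁ (trans (sym eq) eq′))
  joins-functional (inj₂ eq) (inj₁ eq′) = trans (cong proj₁ (trans (sym eq) eq′)) (cong proj₂ (trans (sym eq) eq′))
  joins-functional (inj₂ eq) (inj₂ eq′) = cong proj₁ (trans (sym eq) eq′)

  partner-unique : ∀ {j u w} → Joins j u w → partner u ≡ w
  partner-unique {j} {u} J = joins-functional (partner-joins u) (subst (λ j → Joins j u _) (edgeOf-unique (joins⇒∈ₑ J)) J)

  partner-involutive : ∀ u → partner (partner u) ≡ u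
  partner-involutive u = partner-unique (joins-sym (partner-joins u))

  partner-injective : ∀ {u u′} → partner u ≡ partner u′ → u ≡ u′
  partner-injective {u} {u′} eq =
    trans (sym (partner-involutive u)) (trans (cong partner eq) (partner-involutive u′))

  joins-tensors : ∀ {j u w} → Joins j u w → ends j ≡ (proj₁ u , proj₁ w) ⊎ ends j ≡ (proj₁ w , proj₁ u)
  joins-tensors (inj₁ eq) = inj₁ (cong (λ (u , w) → proj₁ u , proj₁ w) eq)
  joins-tensors (inj₂ eq) = inj₂ (cong (λ (u , w) → proj₁ u , proj₁ w) eq)

  joins-different : ∀ {j u w} → Joins j u w → proj₁ u ≢ proj₁ w
  joins-different {j} J eq with joins-tensors J
  ... | inj₁ ends≡ = different j (trans (cong proj₁ ends≡) (trans eq (sym (cong proj₂ ends≡))))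
  ... | inj₂ ends≡ = different j (trans (cong proj₁ ends≡) (trans (sym eq) (sym (cong proj₂ ends≡))))

  joins-adj : ∀ {j u w} → Joins j u w → Adj (proj₁ u) (proj₁ w)
  joins-adj {j} J = j , joins-tensors J

  partner-adj : ∀ u → Adj (proj₁ u) (proj₁ (partner u))
  partner-adj u = joins-adj (partner-joins u)

  isMode-true⁻ : ∀ k (m : Fin (length (ds k))) w → isMode k (toℕ m) w ≡ true → w ≡ (k , m)
  isMode-true⁻ k m (k′ , m′) eq with k ≟ k′
  ... | yes refl = cong (k ,_) (sym (toℕ-injective (ℕ.≡ᵇ⇒≡ (toℕ m) (toℕ m′) (Equivalence.from T-≡ eq))))
  ... | no  _    with () ← eq

  isMode-self : ∀ k (m : Fin (length (ds k))) → isMode k (toℕ m) (k , m) ≡ true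
  isMode-self k m rewrite dec-true (k ≟ k) refl = Equivalence.to T-≡ (ℕ.≡⇒≡ᵇ (toℕ m) (toℕ m) refl)

  partnerTensor-correct : ∀ k (m : Fin (length (ds k))) → partnerTensor k (toℕ m) ≡ proj₁ (partner (k , m))
  partnerTensor-correct k m = trans (partnerTensor≡search (toℕ m)) (search-correct (allFin n) (∈-allFin _))
    where
    open PartnerSearch ds E k
    search-correct : ∀ L → edgeOf (k , m) ∈ L → search (toℕ m) L ≡ proj₁ (partner (k , m))
    search-correct (j ∷ L) j∈L with isMode k (toℕ m) (proj₁ (E j)) in first
    ... | true = sym (cong proj₁ (partner-unique (inj₁ (cong (_, proj₂ (E j)) (isMode-true⁻ k m _ first)))))
    ... | false with isMode k (toℕ m) (proj₂ (E j)) in second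
    ...   | true = sym (cong proj₁ (partner-unique (inj₂ (cong (proj₁ (E j) ,_) (isMode-true⁻ k m _ second)))))
    ...   | false with j∈L
    ...     | there j∈L′ = search-correct L j∈L′
    ...     | here refl  with proj₁ (proj₂ (exactlyOnce (k , m)))
    ...       | inj₁ eq with () ← trans (sym first) (trans (cong (isMode k (toℕ m)) eq) (isMode-self k m))
    ...       | inj₂ eq with () ← trans (sym second) (trans (cong (isMode k (toℕ m)) eq) (isMode-self k m))

module RootedTree {p n : ℕ} (ds : Fin p → List ℕ) (E : Fin n → Mode ds × Mode ds)
  (different : Graph.DifferentTensors ds E) (exactlyOnce : Graph.ExactlyOnce ds E)
  (o : Fin p) (arranged : Graph.ArrangedFor ds E o) where

  open Graph ds E
  open Paths ds E
  open Contractions ds E different exactlyOnce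
  open import Data.Nat.Base using (_+_)

  parentMode : ∀ l → l ≢ o → Fin (length (ds l))
  parentMode l l≢o = proj₁ (arranged l l≢o)

  parentMode-zero : ∀ l l≢o → toℕ (parentMode l l≢o) ≡ 0
  parentMode-zero l l≢o = proj₁ (proj₂ (arranged l l≢o))

  parentMode-unique : ∀ l l≢o {z : Fin (length (ds l))} → toℕ z ≡ 0 → parentMode l l≢o ≡ z
  parentMode-unique l l≢o z≡0 = toℕ-injective (trans (parentMode-zero l l≢o) (sym z≡0))

  parentMode-partner : ∀ l → l ≢ o → Mode ds
  parentMode-partner l l≢o = partner (l , parentMode l l≢o)

  distances : ∀ l (l≢o : l ≢ o) →
    ∃[ d ] (IsDist o (proj₁ (parentMode-partner l l≢o)) d × IsDist o l (suc d))
  distances l l≢o = proj₂ (proj₂ (arranged l l≢o)) _ _ (partner-joins (l , parentMode l l≢o))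

  -- The root is its own parent; this junk value keeps parent total.
  parent-by : ∀ l → Dec (l ≡ o) → Fin p
  parent-by l (yes _)   = o
  parent-by l (no  l≢o) = proj₁ (parentMode-partner l l≢o)

  parent : Fin p → Fin p
  parent l = parent-by l (l ≟ o)

  depth-by : ∀ l → Dec (l ≡ o) → ℕ
  depth-by l (yes _)   = 0
  depth-by l (no  l≢o) = suc (proj₁ (distances l l≢o))

  depth : Fin p → ℕ
  depth l = depth-by l (l ≟ o)

  parent-root : parent o ≡ o
  parent-root with o ≟ o
  ... | yes _   = refl
  ... | no  o≢o = ⊥-elim (o≢o refl)

  depth-root : depth o ≡ 0
  depth-root with o ≟ o
  ... | yes _   = refl
  ... | no  o≢o = ⊥-elim (o≢o refl)

  parent≡ : ∀ l (l≢o : l ≢ o) → parent l ≡ proj₁ (parentMode-partner l l≢o)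
  parent≡ l l≢o with l ≟ o
  ... | yes l≡o  = ⊥-elim (l≢o l≡o)
  ... | no  l≢o′ = cong (λ z → proj₁ (partner (l , z))) (parentMode-unique l l≢o′ (parentMode-zero l l≢o))

  depth≡0⇒root : ∀ l → depth l ≡ 0 → l ≡ o
  depth≡0⇒root l with l ≟ o
  ... | yes l≡o = λ _ → l≡o
  ... | no  _   = λ ()

  isDist-depth : ∀ l → IsDist o l (depth l)
  isDist-depth l with l ≟ o
  ... | yes refl = here , (λ _ _ → z≤n)
  ... | no  l≢o  = proj₂ (proj₂ (distances l l≢o))

  depth-parent : ∀ l → l ≢ o → suc (depth (parent l)) ≡ depth l
  depth-parent l l≢o = trans (cong suc (isDist-unique (isDist-depth (parent l)) dist-parent))
                             (isDist-unique (proj₂ (proj₂ (distances l l≢o))) (isDist-depth l))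
    where
    dist-parent : IsDist o (parent l) (proj₁ (distances l l≢o))
    dist-parent = subst (λ x → IsDist o x (proj₁ (distances l l≢o))) (sym (parent≡ l l≢o))
                        (proj₁ (proj₂ (distances l l≢o)))

  depth-parent< : ∀ l → l ≢ o → depth (parent l) < depth l
  depth-parent< l l≢o = ℕ.≤-reflexive (depth-parent l l≢o)

  adj-parent : ∀ l → l ≢ o → Adj l (parent l)
  adj-parent l l≢o = subst (Adj l) (sym (parent≡ l l≢o)) (partner-adj (l , parentMode l l≢o))

  depth-adj : ∀ {a b} → Adj a b → depth b ≤ suc (depth a)
  depth-adj {a} {b} a~b = proj₂ (isDist-depth b) _ (walk-snoc (proj₁ (isDist-depth a)) a~b)

  depth-parent-∸ : ∀ x → depth (parent x) ≡ depth x ∸ 1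
  depth-parent-∸ x = by-cases (x ≟ o)
    where
    by-cases : Dec (x ≡ o) → depth (parent x) ≡ depth x ∸ 1
    by-cases (yes refl) = trans (cong depth parent-root) (trans depth-root (cong (_∸ 1) (sym depth-root)))
    by-cases (no  x≢o)  = cong (_∸ 1) (depth-parent x x≢o)

  depth-parent≤ : ∀ x → depth (parent x) ≤ depth x
  depth-parent≤ x = subst (_≤ depth x) (sym (depth-parent-∸ x)) (ℕ.m∸n≤m (depth x) 1)

  ancestor : ℕ → Fin p → Fin p
  ancestor zero    x = x
  ancestor (suc i) x = parent (ancestor i x)

  ancestor-parent : ∀ i k → ancestor i (parent k) ≡ parent (ancestor i k)
  ancestor-parent zero    k = refl
  ancestor-parent (suc i) k = cong parent (ancestor-parent i k)

  depth-ancestor : ∀ i x → depth (ancestor i x) ≡ depth x ∸ i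
  depth-ancestor zero    x = refl
  depth-ancestor (suc i) x = begin
    depth (parent (ancestor i x)) ≡⟨ depth-parent-∸ (ancestor i x) ⟩
    depth (ancestor i x) ∸ 1      ≡⟨ cong (_∸ 1) (depth-ancestor i x) ⟩
    depth x ∸ i ∸ 1               ≡⟨ ℕ.∸-+-assoc (depth x) i 1 ⟩
    depth x ∸ (i + 1)             ≡⟨ cong (depth x ∸_) (ℕ.+-comm i 1) ⟩
    depth x ∸ suc i               ∎
    where open ≡-Reasoning

  -- Pigeonhole: two of the ancestors of k at heights 0, …, p coincide, yet their depths differ if depth k ≥ p.
  depth<p : ∀ k → depth k < p
  depth<p k with depth k ℕ.<? p
  ... | yes depth<p = depth<p
  ... | no  depth≮p
    with i , j , i<j , same ← pigeonhole (s≤s (ℕ.≮⇒≥ depth≮p)) (λ i → ancestor (toℕ i) k)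
    = ⊥-elim (ℕ.<-irrefl
        (trans (sym (depth-ancestor (toℕ j) k)) (trans (cong depth (sym same)) (depth-ancestor (toℕ i) k)))
        (ℕ.∸-monoʳ-< i<j (ℕ.≤-pred (toℕ<n j))))

  _≼_ : Fin p → Fin p → Set
  v ≼ k = ancestor (depth k ∸ depth v) k ≡ v

  inSubtree : Fin p → Fin p → Bool
  inSubtree v k = does (ancestor (depth k ∸ depth v) k ≟ v)

  inSubtree⇒≼ : ∀ {v k} → inSubtree v k ≡ true → v ≼ k
  inSubtree⇒≼ {v} {k} = from-does (ancestor (depth k ∸ depth v) k ≟ v)

  ≼⇒inSubtree : ∀ {v k} → v ≼ k → inSubtree v k ≡ true
  ≼⇒inSubtree {v} {k} = dec-true (ancestor (depth k ∸ depth v) k ≟ v)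

  ⋠⇒inSubtree : ∀ {v k} → ¬ v ≼ k → inSubtree v k ≡ false
  ⋠⇒inSubtree {v} {k} = dec-false (ancestor (depth k ∸ depth v) k ≟ v)

  ≼-depth : ∀ {v k} → v ≼ k → depth v ≤ depth k
  ≼-depth {v} {k} v≼k = subst (_≤ depth k) (trans (sym (depth-ancestor (depth k ∸ depth v) k)) (cong depth v≼k))
                              (ℕ.m∸n≤m (depth k) (depth k ∸ depth v))

  ≼-refl : ∀ v → v ≼ v
  ≼-refl v = cong (λ i → ancestor i v) (ℕ.n∸n≡0 (depth v))

  root-≼ : ∀ k → o ≼ k
  root-≼ k = depth≡0⇒root (ancestor (depth k ∸ depth o) k) (begin
    depth (ancestor (depth k ∸ depth o) k) ≡⟨ depth-ancestor (depth k ∸ depth o) k ⟩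
    depth k ∸ (depth k ∸ depth o)          ≡⟨ cong (λ d → depth k ∸ (depth k ∸ d)) depth-root ⟩
    depth k ∸ (depth k ∸ 0)                ≡⟨ ℕ.n∸n≡0 (depth k) ⟩
    0                                      ∎)
    where open ≡-Reasoning

  parent-≼ : ∀ {c k} → c ≢ o → c ≼ k → parent c ≼ k
  parent-≼ {c} {k} c≢o c≼k = trans (cong (λ i → ancestor i k) height) (cong parent c≼k)
    where
    height : depth k ∸ depth (parent c) ≡ suc (depth k ∸ depth c)
    height = trans (∸-suc (subst (_≤ depth k) (sym (depth-parent c c≢o)) (≼-depth c≼k)))
                   (cong (λ d → suc (depth k ∸ d)) (depth-parent c c≢o))

  ≼-unique : ∀ {c c′ k} → c ≼ k → c′ ≼ k → depth c ≡ depth c′ → c ≡ c′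
  ≼-unique {k = k} c≼k c′≼k same = trans (sym c≼k) (trans (cong (λ d → ancestor (depth k ∸ d) k) same) c′≼k)

  ≼-≢⇒< : ∀ {v k} → v ≼ k → k ≢ v → depth v < depth k
  ≼-≢⇒< {v} {k} v≼k k≢v with ℕ.m≤n⇒m<n∨m≡n (≼-depth v≼k)
  ... | inj₁ v<k  = v<k
  ... | inj₂ v≡k = ⊥-elim (k≢v (trans (cong (λ i → ancestor i k) height≡0) v≼k))
    where
    height≡0 : 0 ≡ depth k ∸ depth v
    height≡0 = sym (trans (cong (depth k ∸_) v≡k) (ℕ.n∸n≡0 (depth k)))

  ≼-next : ∀ {v k} → v ≼ k → k ≢ v →
    Σ[ c ∈ Fin p ] (c ≢ o × parent c ≡ v × c ≼ k × depth c ≡ suc (depth v))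
  ≼-next {v} {k} v≼k k≢v = c , c≢o , parent-c , c≼k , depth-c
    where
    v<k : depth v < depth k
    v<k = ≼-≢⇒< v≼k k≢v
    c = ancestor (depth k ∸ suc (depth v)) k
    parent-c : parent c ≡ v
    parent-c = trans (cong (λ i → ancestor i k) (sym (∸-suc v<k))) v≼k
    depth-c : depth c ≡ suc (depth v)
    depth-c = trans (depth-ancestor (depth k ∸ suc (depth v)) k) (ℕ.m∸[m∸n]≡n v<k)
    c≢o : c ≢ o
    c≢o c≡o with () ← trans (sym depth-c) (trans (cong depth c≡o) depth-root)
    c≼k : c ≼ k
    c≼k = cong (λ d → ancestor (depth k ∸ d) k) depth-c

  ≼-parent : ∀ {v k} → v ≼ k → k ≢ v → v ≼ parent k
  ≼-parent {v} {k} v≼k k≢v = begin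
    ancestor (depth (parent k) ∸ depth v) (parent k)
      ≡⟨ cong (λ d → ancestor (d ∸ suc (depth v)) (parent k)) (depth-parent k k≢o) ⟩
    ancestor (depth k ∸ suc (depth v)) (parent k)    ≡⟨ ancestor-parent (depth k ∸ suc (depth v)) k ⟩
    ancestor (suc (depth k ∸ suc (depth v))) k       ≡⟨ cong (λ i → ancestor i k) (∸-suc v<k) ⟨
    ancestor (depth k ∸ depth v) k                   ≡⟨ v≼k ⟩
    v                                                ∎
    where
    open ≡-Reasoning
    v<k : depth v < depth k
    v<k = ≼-≢⇒< v≼k k≢v
    k≢o : k ≢ o
    k≢o refl = ℕ.n≮0 (subst (depth v <_) depth-root v<k)

  ChildMode : Mode ds → Set
  ChildMode (v , m) = v ≡ o ⊎ toℕ m ≢ 0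

  childMode? : ∀ u → Dec (ChildMode u)
  childMode? (v , m) with v ≟ o | toℕ m ℕ.≟ 0
  ... | yes v≡o | _       = yes (inj₁ v≡o)
  ... | no  _   | no  m≢0 = yes (inj₂ m≢0)
  ... | no  v≢o | yes m≡0 = no λ { (inj₁ v≡o) → v≢o v≡o ; (inj₂ m≢0) → m≢0 m≡0 }

  parentMode-partner-childMode : ∀ c (c≢o : c ≢ o) → ChildMode (parentMode-partner c c≢o)
  parentMode-partner-childMode c c≢o with proj₁ w ≟ o | toℕ (proj₂ w) ℕ.≟ 0
    where w = parentMode-partner c c≢o
  ... | yes v≡o | _       = inj₁ v≡o
  ... | no  _   | no  m≢0 = inj₂ m≢0
  ... | no  v≢o | yes m≡0 = ⊥-elim (ℕ.<-irrefl two-up (ℕ.m<n⇒m<1+n (ℕ.n<1+n (depth c))))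
    where
    w = parentMode-partner c c≢o
    v = proj₁ w
    parent-v : parent v ≡ c
    parent-v = begin
      parent v                                ≡⟨ parent≡ v v≢o ⟩
      proj₁ (partner (v , parentMode v v≢o))  ≡⟨ cong (λ m → proj₁ (partner (v , m))) (parentMode-unique v v≢o m≡0) ⟩
      proj₁ (partner w)                       ≡⟨ cong proj₁ (partner-involutive (c , parentMode c c≢o)) ⟩
      c                                       ∎
      where open ≡-Reasoning
    two-up : depth c ≡ suc (suc (depth c))
    two-up = begin
      depth c                          ≡⟨ depth-parent c c≢o ⟨
      suc (depth (parent c))           ≡⟨ cong (suc ∘ depth) (parent≡ c c≢o) ⟩
      suc (depth v)                    ≡⟨ cong suc (depth-parent v v≢o) ⟨
      suc (suc (depth (parent v)))     ≡⟨ cong (suc ∘ suc ∘ depth) parent-v ⟩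
      suc (suc (depth c))              ∎
      where open ≡-Reasoning

  module Acyclic (atMostOne : Graph.AtMostOne ds E) (acyclic : Graph.Acyclic ds E) where

    parallel-absurd : ∀ {a} {m m′ : Fin (length (ds a))} {w w′ j j′} →
      Joins j (a , m) w → Joins j′ (a , m′) w′ → proj₁ w ≡ proj₁ w′ → m ≢ m′ → ⊥
    parallel-absurd {a} {m} {m′} {w} {w′} {j} {j′} J J′ same m≢m′ = j≢j′ (atMostOne j j′ same-ends)
      where
      j≢j′ : j ≢ j′
      j≢j′ refl with joins-endpoint J (joins⇒∈ₑ J′)
      ... | inj₁ refl = m≢m′ refl
      ... | inj₂ eq   = joins-different J (cong proj₁ eq)
      same-ends : ends j ≡ ends j′ ⊎ (proj₁ (ends j) ≡ proj₂ (ends j′) × proj₂ (ends j) ≡ proj₁ (ends j′))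
      same-ends with joins-tensors J | joins-tensors J′
      ... | inj₁ eq | inj₁ eq′ = inj₁ (trans eq (trans (cong (a ,_) same) (sym eq′)))
      ... | inj₁ eq | inj₂ eq′ = inj₂ ( trans (cong proj₁ eq) (sym (cong proj₂ eq′))
                                      , trans (cong proj₂ eq) (trans same (sym (cong proj₁ eq′))))
      ... | inj₂ eq | inj₁ eq′ = inj₂ ( trans (cong proj₁ eq) (trans same (sym (cong proj₂ eq′)))
                                      , trans (cong proj₂ eq) (sym (cong proj₁ eq′)))
      ... | inj₂ eq | inj₂ eq′ = inj₁ (trans eq (trans (cong (_, a) same) (sym eq′)))

    ParentNot : Fin p → Fin p → Set
    ParentNot a b = a ≢ o → parent a ≢ b

    record Branches (v c x y : Fin p) (Tx Ty : List (Fin p)) : Set where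
      field
        path-x   : Path x v (x ∷ Tx)
        path-y   : Path y c (y ∷ Ty)
        unique-x : Unique (x ∷ Tx)
        unique-y : Unique (y ∷ Ty)
        disjoint : ∀ {w} → w ∈ x ∷ Tx → w ∈ y ∷ Ty → ⊥
        below-x  : All (λ w → depth x < depth w) Tx
        below-y  : All (λ w → depth y < depth w) Ty
        x≤1+y    : depth x ≤ suc (depth y)
        y≤1+x    : depth y ≤ suc (depth x)

    swap : ∀ {v c x y Tx Ty} → Branches v c x y Tx Ty → Branches c v y x Ty Tx
    swap b = record
      { path-x = path-y ; path-y = path-x ; unique-x = unique-y ; unique-y = unique-x
      ; disjoint = λ w∈y w∈x → disjoint w∈x w∈y
      ; below-x = below-y ; below-y = below-x ; x≤1+y = y≤1+x ; y≤1+x = x≤1+y }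
      where open Branches b

    branches-meet : ∀ {v c x y Tx Ty} → Branches v c x y Tx Ty → (x≢o : x ≢ o) → parent x ≡ y →
      Adj c v → ParentNot v c → ⊥
    branches-meet {v} {c} {x} {y} {Tx} {Ty} b x≢o x′≡y c~v ¬vc =
      acyclic _ (path-cycle cycle c~v unique-cycle (long Tx Ty path-x path-y))
      where
      open Branches b
      cycle : Path v c (reverse (x ∷ Tx) ++ (y ∷ Ty))
      cycle = path-++ (path-reverse path-x) (subst (Adj x) x′≡y (adj-parent x x≢o)) path-y
      unique-cycle : Unique (reverse (x ∷ Tx) ++ (y ∷ Ty))
      unique-cycle = Unique.++⁺ (unique-reverse _ unique-x) unique-y (λ (w∈x , w∈y) → disjoint (reverse⁻ w∈x) w∈y)
      length-cycle : ∀ Tx Ty → length (reverse (x ∷ Tx) ++ (y ∷ Ty)) ≡ length (x ∷ Tx) + length (y ∷ Ty)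
      length-cycle Tx Ty = trans (length-++ (reverse (x ∷ Tx))) (cong (_+ suc (length Ty)) (length-reverse (x ∷ Tx)))
      long : ∀ Tx Ty → Path x v (x ∷ Tx) → Path y c (y ∷ Ty) → 3 ≤ length (reverse (x ∷ Tx) ++ (y ∷ Ty))
      long []        []         [ _ ] [ _ ] = ⊥-elim (¬vc x≢o x′≡y)
      long (t ∷ Tx′) Ty         _     _     = subst (3 ≤_) (sym (length-cycle (t ∷ Tx′) Ty))
        (s≤s (s≤s (ℕ.≤-trans (s≤s z≤n) (ℕ.m≤n+m (suc (length Ty)) (length Tx′)))))
      long []        Ty@(_ ∷ _) _     _     = subst (3 ≤_) (sym (length-cycle [] Ty)) (s≤s (s≤s (s≤s z≤n)))

    branches-extend : ∀ {v c x y Tx Ty} → Branches v c x y Tx Ty → depth y ≤ depth x → (x≢o : x ≢ o) → parent x ≢ y →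
      Branches v c (parent x) y (x ∷ Tx) Ty
    branches-extend {x = x} {y} {Tx} {Ty} b y≤x x≢o x′≢y = record
      { path-x   = adj-sym (adj-parent x x≢o) ∷ path-x
      ; path-y   = path-y
      ; unique-x = All.map (λ x′<w x′≡w → ℕ.<-irrefl (cong depth x′≡w) x′<w) below-x′ ∷ unique-x
      ; unique-y = unique-y
      ; disjoint = λ { (here refl) (here refl) → x′≢y refl
                     ; (here refl) (there x′∈Ty) → x′∉Ty x′∈Ty
                     ; (there w∈x) w∈y → disjoint w∈x w∈y }
      ; below-x  = below-x′
      ; below-y  = below-y
      ; x≤1+y    = ℕ.≤-trans (ℕ.<⇒≤ x′<x) x≤1+y
      ; y≤1+x    = subst (depth y ≤_) (sym (depth-parent x x≢o)) y≤x
      }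
      where
      open Branches b
      x′<x : depth (parent x) < depth x
      x′<x = depth-parent< x x≢o
      x′∉Ty : parent x ∈ Ty → ⊥
      x′∉Ty x′∈Ty = ℕ.<-irrefl refl (ℕ.<-≤-trans (All.lookup below-y x′∈Ty)
        (ℕ.≤-pred (subst (_≤ suc (depth y)) (sym (depth-parent x x≢o)) x≤1+y)))
      below-x′ : All (λ w → depth (parent x) < depth w) (x ∷ Tx)
      below-x′ = x′<x ∷ All.map (ℕ.<-trans x′<x) below-x

    -- Walking up the deeper branch keeps both branches disjoint until they meet, closing a cycle.
    mutual
      branches-absurd : ∀ N {v c x y Tx Ty} → Branches v c x y Tx Ty → depth x + depth y ≤ N →
        Adj c v → ParentNot v c → ParentNot c v → ⊥
      branches-absurd zero    {x = x} {y} b x+y≤0 _ _ _ = Branches.disjoint b (here refl)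
        (here (trans (depth≡0⇒root x (ℕ.m+n≡0⇒m≡0 _ (ℕ.n≤0⇒n≡0 x+y≤0)))
                     (sym (depth≡0⇒root y (ℕ.m+n≡0⇒n≡0 (depth x) (ℕ.n≤0⇒n≡0 x+y≤0))))))
      branches-absurd (suc N) {x = x} {y} b x+y≤ c~v ¬vc ¬cv with depth y ℕ.≤? depth x
      ... | yes y≤x = climb N b y≤x x+y≤ c~v ¬vc ¬cv
      ... | no  y≰x = climb N (swap b) (ℕ.<⇒≤ (ℕ.≰⇒> y≰x)) (subst (_≤ suc N) (ℕ.+-comm (depth x) (depth y)) x+y≤)
                            (adj-sym c~v) ¬cv ¬vc

      climb : ∀ N {v c x y Tx Ty} → Branches v c x y Tx Ty → depth y ≤ depth x → depth x + depth y ≤ suc N →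
        Adj c v → ParentNot v c → ParentNot c v → ⊥
      climb N {x = x} {y} b y≤x x+y≤ c~v ¬vc ¬cv = at-root? (x ≟ o)
        where
        at-root? : Dec (x ≡ o) → ⊥
        at-root? (yes x≡o) = Branches.disjoint b (here refl) (here (trans x≡o (sym (depth≡0⇒root y
          (ℕ.n≤0⇒n≡0 (subst (depth y ≤_) (trans (cong depth x≡o) depth-root) y≤x))))))
        at-root? (no x≢o) with parent x ≟ y
        ... | yes x′≡y = branches-meet b x≢o x′≡y c~v ¬vc
        ... | no  x′≢y = branches-absurd N (branches-extend b y≤x x≢o x′≢y)
          (ℕ.≤-pred (subst (λ d → d + depth y ≤ suc N) (sym (depth-parent x x≢o)) x+y≤)) c~v ¬vc ¬cv

    childMode-parentNot : ∀ {u} → ChildMode u → ParentNot (proj₁ u) (proj₁ (partner u))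
    childMode-parentNot {v , m} child v≢o parent≡c =
      parallel-absurd (partner-joins (v , m)) (partner-joins (v , parentMode v v≢o))
                      (trans (sym parent≡c) (parent≡ v v≢o)) m≢parentMode
      where
      m≢parentMode : m ≢ parentMode v v≢o
      m≢parentMode refl = nonzero child (parentMode-zero v v≢o)
        where
        nonzero : ChildMode (v , m) → toℕ m ≢ 0
        nonzero (inj₁ v≡o) = ⊥-elim (v≢o v≡o)
        nonzero (inj₂ m≢0) = m≢0

    childModes-not-joined : ∀ u → ChildMode u → ChildMode (partner u) → ⊥
    childModes-not-joined u@(v , m) child-u child-w =
      branches-absurd (depth v + depth c) initial ℕ.≤-refl (adj-sym (partner-adj u))
        (childMode-parentNot child-u)
        (subst (ParentNot c) (cong proj₁ (partner-involutive u)) (childMode-parentNot child-w))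
      where
      c = proj₁ (partner u)
      initial : Branches v c v c [] []
      initial = record
        { path-x = [ v ] ; path-y = [ c ] ; unique-x = [] ∷ [] ; unique-y = [] ∷ []
        ; disjoint = λ { (here refl) (here v≡c) → joins-different (partner-joins u) v≡c }
        ; below-x = [] ; below-y = []
        ; x≤1+y = depth-adj (adj-sym (partner-adj u)) ; y≤1+x = depth-adj (partner-adj u) }

    childMode-partner : ∀ u → ChildMode u → proj₁ (partner u) ≢ o × toℕ (proj₂ (partner u)) ≡ 0
    childMode-partner u child-u with proj₁ (partner u) ≟ o | toℕ (proj₂ (partner u)) ℕ.≟ 0
    ... | no c≢o | yes w≡0 = c≢o , w≡0
    ... | yes c≡o | _      = ⊥-elim (childModes-not-joined u child-u (inj₁ c≡o))
    ... | no _   | no w≢0  = ⊥-elim (childModes-not-joined u child-u (inj₂ w≢0))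

    parentMode-partner-of-partner : ∀ u → ChildMode u → (c≢o : proj₁ (partner u) ≢ o) →
      parentMode-partner (proj₁ (partner u)) c≢o ≡ u
    parentMode-partner-of-partner u child c≢o =
      trans (cong (λ m → partner (_ , m)) (parentMode-unique _ c≢o (proj₂ (childMode-partner u child))))
            (partner-involutive u)

    parent-partner : ∀ u → ChildMode u → parent (proj₁ (partner u)) ≡ proj₁ u
    parent-partner u child = trans (parent≡ _ c≢o) (cong proj₁ (parentMode-partner-of-partner u child c≢o))
      where
      c≢o : proj₁ (partner u) ≢ o
      c≢o = proj₁ (childMode-partner u child)

    childOf : ∀ c (c≢o : c ≢ o) v → parent c ≡ v →
      Σ[ m ∈ Fin (length (ds v)) ] (ChildMode (v , m) × partner (v , m) ≡ (c , parentMode c c≢o))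
    childOf c c≢o v parent-c = mode-of (parentMode-partner c c≢o) (trans (sym (parent≡ c c≢o)) parent-c)
      (parentMode-partner-childMode c c≢o) (partner-involutive (c , parentMode c c≢o))
      where
      mode-of : ∀ w → proj₁ w ≡ v → ChildMode w → partner w ≡ (c , parentMode c c≢o) →
        Σ[ m ∈ Fin (length (ds v)) ] (ChildMode (v , m) × partner (v , m) ≡ (c , parentMode c c≢o))
      mode-of (.v , m) refl child-w partner≡ = m , child-w , partner≡

    record ChildEnumeration (v : Fin p) (K : ℕ) : Set where
      field
        modeNumber           : Fin K → ℕ
        modeNumber-injective : ∀ r r′ → modeNumber r ≡ modeNumber r′ → r ≡ r′
        mode                 : Fin K → Fin (length (ds v))
        toℕ-mode             : ∀ r → toℕ (mode r) ≡ modeNumber r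
        mode-child           : ∀ r → ChildMode (v , mode r)
        mode-cover           : ∀ m → ChildMode (v , m) → Σ[ r ∈ Fin K ] modeNumber r ≡ toℕ m

    module Children {v K} (enum : ChildEnumeration v K) where

      open ChildEnumeration enum

      child : Fin K → Fin p
      child r = partnerTensor v (modeNumber r)

      child≡ : ∀ r → child r ≡ proj₁ (partner (v , mode r))
      child≡ r = trans (cong (partnerTensor v) (sym (toℕ-mode r))) (partnerTensor-correct v (mode r))

      child≢o : ∀ r → child r ≢ o
      child≢o r child≡o = proj₁ (childMode-partner _ (mode-child r)) (trans (sym (child≡ r)) child≡o)

      parent-child : ∀ r → parent (child r) ≡ v
      parent-child r = trans (cong parent (child≡ r)) (parent-partner _ (mode-child r))

      depth-child : ∀ r → depth (child r) ≡ suc (depth v)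
      depth-child r = trans (sym (depth-parent (child r) (child≢o r))) (cong (suc ∘ depth) (parent-child r))

      child-injective : ∀ r r′ → child r ≡ child r′ → r ≡ r′
      child-injective r r′ same = modeNumber-injective r r′ (begin
        modeNumber r                  ≡⟨ toℕ-mode r ⟨
        toℕ (mode r)                  ≡⟨ cong (toℕ ∘ proj₂) (partner-injective same-partner) ⟩
        toℕ (mode r′)                 ≡⟨ toℕ-mode r′ ⟩
        modeNumber r′                 ∎)
        where
        open ≡-Reasoning
        same-partner : partner (v , mode r) ≡ partner (v , mode r′)
        same-partner = mode-≡ (trans (sym (child≡ r)) (trans same (child≡ r′)))
          (trans (proj₂ (childMode-partner _ (mode-child r))) (sym (proj₂ (childMode-partner _ (mode-child r′)))))

      parentMode-partner-child : ∀ r → parentMode-partner (child r) (child≢o r) ≡ (v , mode r)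
      parentMode-partner-child r = at (child r) (child≡ r) (child≢o r)
        where
        at : ∀ c → c ≡ proj₁ (partner (v , mode r)) → (c≢o : c ≢ o) → parentMode-partner c c≢o ≡ (v , mode r)
        at _ refl c≢o = parentMode-partner-of-partner _ (mode-child r) c≢o

      child-≼ : ∀ r {k} → child r ≼ k → v ≼ k
      child-≼ r c≼k = subst (_≼ _) (parent-child r) (parent-≼ (child≢o r) c≼k)

      child-≼-≢ : ∀ r {k} → child r ≼ k → k ≢ v
      child-≼-≢ r {k} c≼k refl = ℕ.<-irrefl refl (subst (_≤ depth k) (depth-child r) (≼-depth c≼k))

      child-≼-unique : ∀ r r′ {k} → child r ≼ k → child r′ ≼ k → r ≡ r′
      child-≼-unique r r′ c≼k c′≼k =
        child-injective r r′ (≼-unique c≼k c′≼k (trans (depth-child r) (sym (depth-child r′))))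

      ≼-child : ∀ {k} → v ≼ k → k ≢ v → Σ[ r ∈ Fin K ] child r ≼ k
      ≼-child {k} v≼k k≢v
        with c , c≢o , parent-c , c≼k , _ ← ≼-next v≼k k≢v
        with m , child-m , partner≡ ← childOf c c≢o v parent-c
        with r , number≡ ← mode-cover m child-m
        = r , subst (_≼ k) (sym child-r≡c) c≼k
        where
        child-r≡c : child r ≡ c
        child-r≡c = trans (cong (partnerTensor v) number≡) (trans (partnerTensor-correct v m) (cong proj₁ partner≡))

    rootChildren : ChildEnumeration o (length (ds o))
    rootChildren = record
      { modeNumber = toℕ ; modeNumber-injective = λ _ _ → toℕ-injective
      ; mode = λ r → r ; toℕ-mode = λ _ → refl ; mode-child = λ _ → inj₁ refl ; mode-cover = λ m _ → m , refl }

    nonRootChildren : ∀ v → v ≢ o → ChildEnumeration v (length (tailL (ds v)))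
    nonRootChildren v v≢o = record
      { modeNumber = λ r → suc (toℕ r) ; modeNumber-injective = λ _ _ → toℕ-injective ∘ ℕ.suc-injective
      ; mode = tailMode (ds v) ; toℕ-mode = toℕ-tailMode (ds v)
      ; mode-child = λ r → inj₂ (λ eq → ℕ.1+n≢0 (trans (sym (toℕ-tailMode (ds v) r)) eq))
      ; mode-cover = cover }
      where
      tailMode : ∀ dl → Fin (length (tailL dl)) → Fin (length dl)
      tailMode (_ ∷ _) r = Fin.suc r
      toℕ-tailMode : ∀ dl r → toℕ (tailMode dl r) ≡ suc (toℕ r)
      toℕ-tailMode (_ ∷ _) r = refl
      tail-cover : ∀ dl (m : Fin (length dl)) → toℕ m ≢ 0 → Σ[ r ∈ Fin (length (tailL dl)) ] suc (toℕ r) ≡ toℕ m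
      tail-cover (_ ∷ _) Fin.zero    m≢0 = ⊥-elim (m≢0 refl)
      tail-cover (_ ∷ _) (Fin.suc r) _   = r , refl
      cover : ∀ m → ChildMode (v , m) → Σ[ r ∈ Fin (length (tailL (ds v))) ] suc (toℕ r) ≡ toℕ m
      cover m (inj₁ v≡o) = ⊥-elim (v≢o v≡o)
      cover m (inj₂ m≢0) = tail-cover (ds v) m m≢0

    parentEdge : ∀ c → c ≢ o → Fin n
    parentEdge c c≢o = edgeOf (c , parentMode c c≢o)

    childEnd-by : ∀ j → Dec (ChildMode (proj₁ (E j))) → Fin p
    childEnd-by j (yes _) = proj₁ (proj₂ (E j))
    childEnd-by j (no  _) = proj₁ (proj₁ (E j))

    childEnd : Fin n → Fin p
    childEnd j = childEnd-by j (childMode? (proj₁ (E j)))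

    childEnd-∈ₑ : ∀ j → Σ[ c≢o ∈ childEnd j ≢ o ] (childEnd j , parentMode (childEnd j) c≢o) ∈ₑ E j
    childEnd-∈ₑ j = by-cases (childMode? (proj₁ (E j)))
      where
      by-cases : (d : Dec (ChildMode (proj₁ (E j)))) →
        Σ[ c≢o ∈ childEnd-by j d ≢ o ] (childEnd-by j d , parentMode (childEnd-by j d) c≢o) ∈ₑ E j
      by-cases (yes child) = c≢o , inj₂ (mode-≡ refl (trans w≡0 (sym (parentMode-zero _ c≢o))))
        where
        partner≡ : partner (proj₁ (E j)) ≡ proj₂ (E j)
        partner≡ = partner-unique (inj₁ refl)
        c≢o : proj₁ (proj₂ (E j)) ≢ o
        c≢o = subst (λ w → proj₁ w ≢ o) partner≡ (proj₁ (childMode-partner _ child))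
        w≡0 : toℕ (proj₂ (proj₂ (E j))) ≡ 0
        w≡0 = subst (λ w → toℕ (proj₂ w) ≡ 0) partner≡ (proj₂ (childMode-partner _ child))
      by-cases (no ¬child) = u≢o , inj₁ (mode-≡ refl (trans u≡0 (sym (parentMode-zero _ u≢o))))
        where
        u≢o : proj₁ (proj₁ (E j)) ≢ o
        u≢o = ¬child ∘ inj₁
        u≡0 : toℕ (proj₂ (proj₁ (E j))) ≡ 0
        u≡0 = decidable-stable (toℕ (proj₂ (proj₁ (E j))) ℕ.≟ 0) (¬child ∘ inj₂)

    childEnd-joins : ∀ j → Σ[ c≢o ∈ childEnd j ≢ o ]
      Joins j (childEnd j , parentMode (childEnd j) c≢o) (parentMode-partner (childEnd j) c≢o)
    childEnd-joins j with c≢o , c∈ ← childEnd-∈ₑ j =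
      c≢o , subst (λ j′ → Joins j′ (childEnd j , parentMode (childEnd j) c≢o) (parentMode-partner (childEnd j) c≢o))
                  (sym (edgeOf-unique c∈)) (partner-joins _)

    childEnd≡⇒parentEdge : ∀ c (c≢o : c ≢ o) j → childEnd j ≡ c → j ≡ parentEdge c c≢o
    childEnd≡⇒parentEdge c c≢o j refl with c≢o′ , c∈ ← childEnd-∈ₑ j =
      trans (edgeOf-unique c∈) (cong (λ m → edgeOf (c , m)) (parentMode-unique c c≢o′ (parentMode-zero c c≢o)))

    childEnd-parentEdge : ∀ c (c≢o : c ≢ o) → childEnd (parentEdge c c≢o) ≡ c
    childEnd-parentEdge c c≢o with c′≢o , c′∈ ← childEnd-∈ₑ (parentEdge c c≢o)
      with joins-endpoint (partner-joins (c , parentMode c c≢o)) c′∈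
    ... | inj₁ c′≡c = cong proj₁ c′≡c
    ... | inj₂ c′≡w with parentMode-partner-childMode c c≢o
    ...   | inj₁ w≡o = ⊥-elim (c′≢o (trans (cong proj₁ c′≡w) w≡o))
    ...   | inj₂ w≢0 = ⊥-elim (w≢0 (trans (cong (toℕ ∘ proj₂) (sym c′≡w)) (parentMode-zero _ c′≢o)))


module MessagePassing {c ℓ : Level} (R : CommutativeSemiring c ℓ) {p n : ℕ} (ds : Fin p → List ℕ)
  (X : (k : Fin p) → Net.Tensor R (ds k)) (E : Fin n → Mode ds × Mode ds)
  (different : Graph.DifferentTensors ds E) (exactlyOnce : Graph.ExactlyOnce ds E)
  (atMostOne : Graph.AtMostOne ds E) (acyclic : Graph.Acyclic ds E)
  (o : Fin p) (arranged : Graph.ArrangedFor ds E o) where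

  open CommutativeSemiring R renaming (refl to ≈-refl; sym to ≈-sym; trans to ≈-trans)
  open Net R
  open Sums R
  open PartialSums R ds
  open Graph ds E
  open Contractions ds E different exactlyOnce
  open RootedTree ds E different exactlyOnce o arranged
  open RootedTree.Acyclic ds E different exactlyOnce o arranged atMostOne acyclic
  open G ds X E
  open import Relation.Binary.Reasoning.Setoid setoid

  valueAt : ∀ k → Maybe (Idx (ds k)) → Carrier
  valueAt k (just a) = X k a
  valueAt k nothing  = 0#

  coordinate : ∀ dl → Maybe (Idx dl) → ℕ → ℕ
  coordinate dl (just a) m = idxAt dl a m
  coordinate dl nothing  m = 0

  tensorAt : Fin p → Assignment → Carrier
  tensorAt k i = valueAt k (i k)

  indexAt : Mode ds → Assignment → ℕ
  indexAt (k , m) i = coordinate (ds k) (i k) (toℕ m)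

  contractionAt : Fin n → Assignment → Carrier
  contractionAt j i = iverson (indexAt (proj₁ (E j)) i) (indexAt (proj₂ (E j)) i)

  -- At a total assignment λ k → just (g k) this is the summand of tc.
  fullWeight : Assignment → Carrier
  fullWeight i = prodFin p (λ k → tensorAt k i) * prodFin n (λ j → contractionAt j i)

  subtreeWeight : Fin p → Assignment → Carrier
  subtreeWeight v i = prodFin p (λ k → mask (inSubtree v k) (tensorAt k i))
                    * prodFin n (λ j → mask (inSubtree v (childEnd j)) (contractionAt j i))

  parentFactor : Fin p → Assignment → Carrier
  parentFactor v i = prodFin n (λ j → mask (does (childEnd j ≟ v)) (contractionAt j i))

  message : ℕ → Fin p → ℕ → Carrier
  message f c = padded (headD (ds c)) (matVecT (ds c) (X c) (gNonRoot f c))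

  tensorAt-≐ : ∀ k {i i′} → i ≐ i′ → tensorAt k i ≡ tensorAt k i′
  tensorAt-≐ k i≐i′ = cong (valueAt k) (i≐i′ k)

  indexAt-≐ : ∀ u {i i′} → i ≐ i′ → indexAt u i ≡ indexAt u i′
  indexAt-≐ (k , m) i≐i′ = cong (λ a → coordinate (ds k) a (toℕ m)) (i≐i′ k)

  contractionAt-≐ : ∀ j {i i′} → i ≐ i′ → contractionAt j i ≡ contractionAt j i′
  contractionAt-≐ j i≐i′ = cong₂ iverson (indexAt-≐ (proj₁ (E j)) i≐i′) (indexAt-≐ (proj₂ (E j)) i≐i′)

  fullWeight-extensional : Extensional fullWeight
  fullWeight-extensional i≐i′ = *-cong (prodFin-cong p (λ k → reflexive (tensorAt-≐ k i≐i′)))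
                                       (prodFin-cong n (λ j → reflexive (contractionAt-≐ j i≐i′)))

  subtreeWeight-extensional : ∀ v → Extensional (subtreeWeight v)
  subtreeWeight-extensional v i≐i′ =
    *-cong (prodFin-cong p (λ k → reflexive (cong (mask (inSubtree v k)) (tensorAt-≐ k i≐i′))))
           (prodFin-cong n (λ j → reflexive (cong (mask (inSubtree v (childEnd j))) (contractionAt-≐ j i≐i′))))

  tensorAt-[]≔ : ∀ i {k} a {k′} → k ≢ k′ → tensorAt k′ (i [ k ]≔ a) ≡ tensorAt k′ i
  tensorAt-[]≔ i a k≢k′ = cong (valueAt _) ([]≔-other i a k≢k′)

  indexAt-[]≔ : ∀ i {k} a {u} → k ≢ proj₁ u → indexAt u (i [ k ]≔ a) ≡ indexAt u i
  indexAt-[]≔ i a {k′ , m} k≢k′ = cong (λ a → coordinate (ds k′) a (toℕ m)) ([]≔-other i a k≢k′)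

  contractionAt-joins : ∀ {j u w} i → Joins j u w → contractionAt j i ≡ iverson (indexAt u i) (indexAt w i)
  contractionAt-joins i (inj₁ refl) = refl
  contractionAt-joins {u = u} {w} i (inj₂ eq) rewrite eq = iverson-sym (indexAt w i) (indexAt u i)

  contractionAt-[]≔ : ∀ i {k} a j → k ≢ childEnd j → k ≢ parent (childEnd j) →
    contractionAt j (i [ k ]≔ a) ≡ contractionAt j i
  contractionAt-[]≔ i {k} a j k≢c k≢parent with c≢o , J ← childEnd-joins j =
    trans (contractionAt-joins (i [ k ]≔ a) J)
          (trans (cong₂ iverson (indexAt-[]≔ i a k≢c)
                                (indexAt-[]≔ i a (λ k≡ → k≢parent (trans k≡ (sym (parent≡ _ c≢o))))))
                 (sym (contractionAt-joins i J)))

  subtreeWeight-[]≔ : ∀ v i {k} a → ¬ v ≼ k → k ≢ parent v → subtreeWeight v (i [ k ]≔ a) ≈ subtreeWeight v i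
  subtreeWeight-[]≔ v i {k} a v⋠k k≢parent =
    *-cong (prodFin-cong p (λ k′ → reflexive (mask-≡ (inSubtree v k′) (tensor-unchanged k′))))
           (prodFin-cong n (λ j → reflexive (mask-≡ (inSubtree v (childEnd j)) (contraction-unchanged j))))
    where
    ≢-outside : ∀ {k′} → v ≼ k′ → k ≢ k′
    ≢-outside v≼k′ refl = v⋠k v≼k′
    tensor-unchanged : ∀ k′ → inSubtree v k′ ≡ true → tensorAt k′ (i [ k ]≔ a) ≡ tensorAt k′ i
    tensor-unchanged k′ inside = tensorAt-[]≔ i a (≢-outside (inSubtree⇒≼ inside))
    contraction-unchanged : ∀ j → inSubtree v (childEnd j) ≡ true → contractionAt j (i [ k ]≔ a) ≡ contractionAt j i
    contraction-unchanged j inside = contractionAt-[]≔ i a j (≢-outside v≼c) k≢parent-c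
      where
      v≼c : v ≼ childEnd j
      v≼c = inSubtree⇒≼ inside
      k≢parent-c : k ≢ parent (childEnd j)
      k≢parent-c with childEnd j ≟ v
      ... | yes c≡v = λ k≡ → k≢parent (trans k≡ (cong parent c≡v))
      ... | no  c≢v = ≢-outside (≼-parent v≼c c≢v)

  L : List (Fin p)
  L = allFin p

  SubtreeMessage : ℕ → ∀ c → c ≢ o → Set ℓ
  SubtreeMessage f c c≢o =
    ∀ i → sumOver L (inSubtree c) (subtreeWeight c) i ≈ message f c (indexAt (parentMode-partner c c≢o) i)

  module AtVertex {v K} (enum : ChildEnumeration v K) where

    open ChildEnumeration enum
    open Children enum

    inChild : Fin K → Fin p → Bool
    inChild r = inSubtree (child r)

    inChild-exclusive : PairwiseDisjoint K inChild
    inChild-exclusive r r′ k in-r in-r′ = child-≼-unique r r′ (inSubtree⇒≼ in-r) (inSubtree⇒≼ in-r′)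

    inSubtree-split : ∀ k → inSubtree v k ≡ does (k ≟ v) ∨ ⋃ K inChild k
    inSubtree-split k with k ≟ v
    ... | yes refl = ≼⇒inSubtree (≼-refl v)
    ... | no  k≢v with inSubtree v k in inside
    ...   | true  = let r , c≼k = ≼-child (inSubtree⇒≼ inside) k≢v in sym (⋃-true⁺ K inChild k r (≼⇒inSubtree c≼k))
    ...   | false = sym (⋃-false⁺ K inChild k (λ r → ⋠⇒inSubtree λ c≼k →
                      true≢false (trans (sym (≼⇒inSubtree (child-≼ r c≼k))) inside)))
      where
      true≢false : true ≢ false
      true≢false ()

    mask-split : ∀ k x → mask (inSubtree v k) x ≈ mask (does (k ≟ v)) x * prodFin K (λ r → mask (inChild r k) x)
    mask-split k x = begin
      mask (inSubtree v k) x                                 ≡⟨ cong (λ b → mask b x) (inSubtree-split k) ⟩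
      mask (does (k ≟ v) ∨ ⋃ K inChild k) x                  ≈⟨ mask-∨ (does (k ≟ v)) _ x self-outside-children ⟩
      mask (does (k ≟ v)) x * mask (⋃ K inChild k) x         ≈⟨ *-congˡ (mask-⋃ K _ inChild-exclusive k x) ⟩
      mask (does (k ≟ v)) x * prodFin K (λ r → mask (inChild r k) x) ∎
      where
      self-outside-children : does (k ≟ v) ≡ true → ⋃ K inChild k ≡ false
      self-outside-children k≡v =
        ⋃-false⁺ K inChild k (λ r → ⋠⇒inSubtree λ c≼k → child-≼-≢ r c≼k (from-does (k ≟ v) k≡v))

    prodFin-mask-split : ∀ N (κ : Fin N → Fin p) (f : Fin N → Carrier) →
      prodFin N (λ x → mask (inSubtree v (κ x)) (f x))
        ≈ prodFin N (λ x → mask (does (κ x ≟ v)) (f x))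
          * prodFin K (λ r → prodFin N (λ x → mask (inChild r (κ x)) (f x)))
    prodFin-mask-split N κ f =
      ≈-trans (prodFin-cong N (λ x → mask-split (κ x) (f x))) (≈-trans (prodFin-* N _ _) (*-congˡ (prodFin-comm N K _)))

    localWeight : Assignment → Carrier
    localWeight i = tensorAt v i * parentFactor v i

    subtreeWeight-split : ∀ i → subtreeWeight v i ≈ localWeight i * prodFin K (λ r → subtreeWeight (child r) i)
    subtreeWeight-split i = begin
      subtreeWeight v i
        ≈⟨ *-cong (prodFin-mask-split p (λ k → k) (λ k → tensorAt k i))
                  (prodFin-mask-split n childEnd (λ j → contractionAt j i)) ⟩
      (prodFin p (λ k → mask (does (k ≟ v)) (tensorAt k i)) * prodFin K (λ r → tensors r))
        * (parentFactor v i * prodFin K (λ r → contractions r))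
        ≈⟨ *-congʳ (*-congʳ (prodFin-select p v (λ k → tensorAt k i))) ⟩
      (tensorAt v i * prodFin K tensors) * (parentFactor v i * prodFin K contractions)
        ≈⟨ *-interchange _ _ _ _ ⟩
      localWeight i * (prodFin K tensors * prodFin K contractions)
        ≈⟨ *-congˡ (prodFin-* K tensors contractions) ⟨
      localWeight i * prodFin K (λ r → subtreeWeight (child r) i) ∎
      where
      tensors contractions : Fin K → Carrier
      tensors r      = prodFin p (λ k → mask (inChild r k) (tensorAt k i))
      contractions r = prodFin n (λ j → mask (inChild r (childEnd j)) (contractionAt j i))

    inChild⇒≢ : ∀ {r k} → inChild r k ≡ true → k ≢ v
    inChild⇒≢ {r} in-r = child-≼-≢ r (inSubtree⇒≼ in-r)

    inChild⇒≢parent : ∀ {r k} → inChild r k ≡ true → k ≢ parent v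
    inChild⇒≢parent {r} {k} in-r refl = ℕ.<-irrefl refl
      (ℕ.≤-trans (ℕ.s≤s (depth-parent≤ v)) (subst (_≤ depth k) (depth-child r) (≼-depth (inSubtree⇒≼ in-r))))

    localWeight-independent : Independent (⋃ K inChild) localWeight
    localWeight-independent i k a in-⋃ with r , in-r ← ⋃-true⁻ K inChild k in-⋃ =
      *-cong (reflexive (tensorAt-[]≔ i a (inChild⇒≢ in-r))) (prodFin-cong n unchanged)
      where
      unchanged : ∀ j → mask (does (childEnd j ≟ v)) (contractionAt j (i [ k ]≔ a))
                      ≈ mask (does (childEnd j ≟ v)) (contractionAt j i)
      unchanged j with childEnd j ≟ v
      ... | yes refl = reflexive (contractionAt-[]≔ i a j (inChild⇒≢ in-r) (inChild⇒≢parent in-r))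
      ... | no  _    = ≈-refl

    childMessage : ℕ → Fin K → Assignment → Carrier
    childMessage f r i = message f (child r) (indexAt (v , mode r) i)

    subtreeSum : ∀ f → (∀ r → SubtreeMessage f (child r) (child≢o r)) → ∀ i →
      sumOver L (inSubtree v) (subtreeWeight v) i
        ≈ sumIdx (ds v) (λ a → X v a * (parentFactor v (i [ v ]≔ a) *
                                        prodFin K (λ r → message f (child r) (idxAt (ds v) a (modeNumber r)))))
    subtreeSum f childSums i = begin
      sumOver L (inSubtree v) (subtreeWeight v) i
        ≈⟨ sumOver-predicate-cong L _ inSubtree-split i ⟩
      sumOver L (λ k → does (k ≟ v) ∨ ⋃ K inChild k) (subtreeWeight v) i
        ≈⟨ sumOver-∨ L _ _ _ (Unique.allFin⁺ p) self-outside (subtreeWeight-extensional v) i ⟩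
      sumOver L (λ k → does (k ≟ v)) (sumOver L (⋃ K inChild) (subtreeWeight v)) i
        ≈⟨ sumOver-cong L _ (λ i′ → ≈-trans (sumOver-cong L _ subtreeWeight-split i′)
                                            (sumOver-*ˡ L _ _ localWeight localWeight-independent i′)) i ⟩
      sumOver L (λ k → does (k ≟ v))
        (λ i′ → localWeight i′ * sumOver L (⋃ K inChild) (λ i″ → prodFin K (λ r → subtreeWeight (child r) i″)) i′) i
        ≈⟨ sumOver-cong L _ (λ i′ → *-congˡ (sumOver-⋃-prodFin L (Unique.allFin⁺ p) K inChild _ (childMessage f)
             inChild-exclusive (subtreeWeight-extensional ∘ child) subtree-independent message-independent childSums′ i′)) i ⟩
      sumOver L (λ k → does (k ≟ v)) (λ i′ → localWeight i′ * prodFin K (λ r → childMessage f r i′)) i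
        ≈⟨ sumOver-≟ L _ v (∈-allFin v) (Unique.allFin⁺ p) i ⟩
      sumIdx (ds v) (λ a → localWeight (i [ v ]≔ a) * prodFin K (λ r → childMessage f r (i [ v ]≔ a)))
        ≈⟨ sumIdx-cong (ds v) (λ a → ≈-trans (*-congʳ (*-congʳ (reflexive (cong (valueAt v) ([]≔-same i v a)))))
             (≈-trans (*-assoc _ _ _) (*-congˡ (*-congˡ (prodFin-cong K (λ r → reflexive (at-v a r))))))) ⟩
      sumIdx (ds v) (λ a → X v a * (parentFactor v (i [ v ]≔ a) *
                                    prodFin K (λ r → message f (child r) (idxAt (ds v) a (modeNumber r))))) ∎
      where
      childSums′ : ∀ r i → sumOver L (inChild r) (subtreeWeight (child r)) i ≈ childMessage f r i
      childSums′ r i = ≈-trans (childSums r i)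
        (reflexive (cong (λ u → message f (child r) (indexAt u i)) (parentMode-partner-child r)))
      self-outside : Disjoint (λ k → does (k ≟ v)) (⋃ K inChild)
      self-outside k k≡v in-⋃ with r , in-r ← ⋃-true⁻ K inChild k in-⋃ = inChild⇒≢ in-r (from-does (k ≟ v) k≡v)
      subtree-independent : ∀ r r′ → r ≢ r′ → Independent (inChild r′) (subtreeWeight (child r))
      subtree-independent r r′ r≢r′ i k a in-r′ = subtreeWeight-[]≔ (child r) i a
        (λ c≼k → r≢r′ (inChild-exclusive r r′ k (≼⇒inSubtree c≼k) in-r′))
        (λ k≡ → inChild⇒≢ in-r′ (trans k≡ (parent-child r)))
      message-independent : ∀ r r′ → Independent (inChild r′) (childMessage f r)
      message-independent r r′ i k a in-r′ =
        reflexive (cong (message f (child r)) (indexAt-[]≔ i a (inChild⇒≢ in-r′)))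
      at-v : ∀ a r → childMessage f r (i [ v ]≔ a) ≡ message f (child r) (idxAt (ds v) a (modeNumber r))
      at-v a r = cong (message f (child r)) (trans (cong (λ a′ → coordinate (ds v) a′ (toℕ (mode r))) ([]≔-same i v a))
                                                   (cong (idxAt (ds v) a) (toℕ-mode r)))

  parentFactor-root : ∀ i → parentFactor o i ≈ 1#
  parentFactor-root i = ≈-trans (prodFin-cong n λ j →
      reflexive (cong (λ b → mask b (contractionAt j i)) (dec-false (childEnd j ≟ o) (proj₁ (childEnd-joins j)))))
    (prodFin-one n)

  parentFactor-nonRoot : ∀ c (c≢o : c ≢ o) i → parentFactor c i ≈ contractionAt (parentEdge c c≢o) i
  parentFactor-nonRoot c c≢o i =
    ≈-trans (prodFin-cong n (λ j → reflexive (cong (λ b → mask b (contractionAt j i)) (same-test j))))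
            (prodFin-select n (parentEdge c c≢o) (λ j → contractionAt j i))
    where
    same-test : ∀ j → does (childEnd j ≟ c) ≡ does (j ≟ parentEdge c c≢o)
    same-test j with childEnd j ≟ c | j ≟ parentEdge c c≢o
    ... | yes _     | yes _    = refl
    ... | no  _     | no  _    = refl
    ... | yes c≡    | no  j≢   = ⊥-elim (j≢ (childEnd≡⇒parentEdge c c≢o j c≡))
    ... | no  c≢    | yes refl = ⊥-elim (c≢ (childEnd-parentEdge c c≢o))

  message≡ : ∀ f c m s (y : Fin s) → childVec f c m s y ≡ message f (partnerTensor c m) (toℕ y)
  message≡ f c m s y = castV≡padded (headD (ds l)) s (matVecT (ds l) (X l) (gNonRoot f l)) y
    where l = partnerTensor c m

  -- f is the fuel of gNonRoot, so it has to exceed the height of the subtree of c.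
  messages-correct : ∀ f c (c≢o : c ≢ o) → (∀ k → c ≼ k → depth k < depth c ℕ.+ f) → SubtreeMessage f c c≢o
  messages-correct zero    c c≢o fuel i = ⊥-elim (ℕ.<-irrefl (sym (ℕ.+-identityʳ (depth c))) (fuel c (≼-refl c)))
  messages-correct (suc f) c c≢o fuel i = begin
    sumOver L (inSubtree c) (subtreeWeight c) i
      ≈⟨ subtreeSum f (λ r → messages-correct f (child r) (child≢o r) (fuel′ r)) i ⟩
    sumIdx (ds c) (λ a → X c a * (parentFactor c (i [ c ]≔ a) *
                                  prodFin K (λ r → W (toℕ r) (idxAt (ds c) a (suc (toℕ r))))))
      ≈⟨ sumIdx-cong (ds c) (λ a → *-congˡ (*-congʳ (≈-trans (parentFactor-nonRoot c c≢o (i [ c ]≔ a))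
                                                               (reflexive (parent-contraction a))))) ⟩
    sumIdx (ds c) (λ a → X c a * (iverson (idxAt (ds c) a 0) t *
                                  prodFin K (λ r → W (toℕ r) (idxAt (ds c) a (suc (toℕ r))))))
      ≈⟨ padded-matVecT-kron (ds c) nonempty (X c) (λ m → childVec f c (suc m)) W
           (λ m s y → reflexive (message≡ f c (suc m) s y)) t ⟨
    message (suc f) c t ∎
    where
    open AtVertex (nonRootChildren c c≢o)
    open Children (nonRootChildren c c≢o)
    K = length (tailL (ds c))
    W : ℕ → ℕ → Carrier
    W m = message f (partnerTensor c (suc m))
    t = indexAt (parentMode-partner c c≢o) i
    nonempty : 0 < length (ds c)
    nonempty = ℕ.≤-trans (ℕ.s≤s ℕ.z≤n) (toℕ<n (parentMode c c≢o))
    c≢parent : c ≢ proj₁ (parentMode-partner c c≢o)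
    c≢parent c≡ = ℕ.<-irrefl (cong depth (trans (parent≡ c c≢o) (sym c≡))) (depth-parent< c c≢o)
    parent-contraction : ∀ a → contractionAt (parentEdge c c≢o) (i [ c ]≔ a) ≡ iverson (idxAt (ds c) a 0) t
    parent-contraction a = trans (contractionAt-joins (i [ c ]≔ a) (partner-joins (c , parentMode c c≢o)))
      (cong₂ iverson (trans (cong (λ a′ → coordinate (ds c) a′ (toℕ (parentMode c c≢o))) ([]≔-same i c a))
                            (cong (idxAt (ds c) a) (parentMode-zero c c≢o)))
                     (indexAt-[]≔ i a c≢parent))
    fuel′ : ∀ r k → child r ≼ k → depth k < depth (child r) ℕ.+ f
    fuel′ r k c≼k = subst (depth k <_) (trans (ℕ.+-suc (depth c) f) (cong (ℕ._+ f) (sym (depth-child r))))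
                          (fuel k (child-≼ r c≼k))

  tc≈subtreeSum-root : tc ds X E ≈ sumOver L (inSubtree o) (subtreeWeight o) unassigned
  tc≈subtreeSum-root = begin
    sumΠ p ds (λ g → fullWeight (λ k → just (g k)))
      ≈⟨ sumΠ≈sumOver R p ds fullWeight fullWeight-extensional unassigned ⟩
    sumOver L (λ _ → true) fullWeight unassigned
      ≈⟨ sumOver-cong L _ (λ i → *-cong
           (prodFin-cong p (λ k → reflexive (cong (λ b → mask b (tensorAt k i)) (everywhere k))))
           (prodFin-cong n (λ j → reflexive (cong (λ b → mask b (contractionAt j i)) (everywhere (childEnd j)))))) unassigned ⟩
    sumOver L (λ _ → true) (subtreeWeight o) unassigned
      ≈⟨ sumOver-predicate-cong L (subtreeWeight o) everywhere unassigned ⟩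
    sumOver L (inSubtree o) (subtreeWeight o) unassigned ∎
    where
    everywhere : ∀ k → true ≡ inSubtree o k
    everywhere k = sym (≼⇒inSubtree (root-≼ k))

  subtreeSum-root≈dot :
    sumOver L (inSubtree o) (subtreeWeight o) unassigned ≈ dot (product (ds o)) (vec (ds o) (X o)) (g ds X E o)
  subtreeSum-root≈dot = begin
    sumOver L (inSubtree o) (subtreeWeight o) unassigned
      ≈⟨ subtreeSum p (λ r → messages-correct p (child r) (child≢o r) (λ k _ → ℕ.<-≤-trans (depth<p k) (ℕ.m≤n+m p _)))
                    unassigned ⟩
    sumIdx (ds o) (λ a → X o a * (parentFactor o (unassigned [ o ]≔ a) *
                                  prodFin K (λ r → W (toℕ r) (idxAt (ds o) a (toℕ r)))))
      ≈⟨ sumIdx-cong (ds o) (λ a → *-congˡ (≈-trans (*-congʳ (parentFactor-root (unassigned [ o ]≔ a))) (*-identityˡ _))) ⟩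
    sumIdx (ds o) (λ a → X o a * prodFin K (λ r → W (toℕ r) (idxAt (ds o) a (toℕ r))))
      ≈⟨ dot-vec-kron (ds o) (X o) (childVec p o) W (λ m s y → reflexive (message≡ p o m s y)) ⟨
    dot (product (ds o)) (vec (ds o) (X o)) (g ds X E o) ∎
    where
    open AtVertex rootChildren
    open Children rootChildren
    K = length (ds o)
    W : ℕ → ℕ → Carrier
    W m = message p (partnerTensor o m)

lemma8 : ∀ {c ℓ} (R : CommutativeSemiring c ℓ) →
    (p : ℕ) (ds : Fin p → List ℕ) (X : (k : Fin p) → Net.Tensor R (ds k))
    (n : ℕ) (E : Fin n → Mode ds × Mode ds) →
    Graph.SameSize ds E →
    Graph.DifferentTensors ds E →
    Graph.ExactlyOnce ds E →
    Graph.AtMostOne ds E →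
    Graph.Acyclic ds E →
    Graph.Connected ds E →
    (o : Fin p) →
    Graph.ArrangedFor ds E o →
    CommutativeSemiring._≈_ R (Net.tc R ds X E)
      (Net.dot R (product (ds o)) (Net.vec R (ds o) (X o)) (Net.g R ds X E o))
lemma8 R p ds X n E _ different exactlyOnce atMostOne acyclic _ o arranged = begin
  tc ds X E                                                     ≈⟨ tc≈subtreeSum-root ⟩
  sumOver (allFin p) (inSubtree o) (subtreeWeight o) unassigned ≈⟨ subtreeSum-root≈dot ⟩
  dot (product (ds o)) (vec (ds o) (X o)) (g ds X E o)          ∎
  where
  open CommutativeSemiring R using (setoid)
  open Net R
  open PartialSums R ds using (sumOver; unassigned)
  open RootedTree ds E different exactlyOnce o arranged using (inSubtree)
  open MessagePassing R ds X E different exactlyOnce atMostOne acyclic o arranged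
  open import Relation.Binary.Reasoning.Setoid setoid
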